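{- Let $M=p_1^{n_1}\cdots p_K^{n_K}$ with distinct primes and $n_\nu\in\mathbb{N}$, and let $A\oplus B=\mathbb{Z}_M$. Fix $i,j\in\{1,\dots,K\}$ and let $\Lambda:=\Lambda(z,M/(p_ip_j))$ for some $z\in\mathbb{Z}_M$. Let $a\in A$, $b\in B$ satisfy $a+b=z$. Then there exists $\nu\in\{i,j\}$ such that $\Sigma_A(\Lambda)\subset A\cap\Pi(a,p_\nu^{n_\nu-1})$ and $\Sigma_B(\Lambda)\subset B\cap\Pi(b,p_\nu^{n_\nu-1})$.
   Context: $A\oplus B=\mathbb{Z}_M$ means every element of $\mathbb{Z}_M$ is uniquely $a+b$ with $a\in A,b\in B$. For $x\in\mathbb{Z}_M$ and $d\mid M$, $\Lambda(x,d)=\{x'\in\mathbb{Z}_M:d\mid x-x'\}$ and $\Pi(x,p_\nu^\alpha)=\Lambda(x,p_\nu^\alpha)$. For $Z\subset\mathbb{Z}_M$, $\Sigma_A(Z)=\{a\in A:a+b\in Z\text{ for some }b\in B\}$ and $\Sigma_B(Z)=\{b\in B:a+b\in Z\text{ for some }a\in A\}$. -}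

module Defs where

open import Data.Nat using (ℕ; _^_; _∸_)
open import Data.Nat.ListAction using (product)
open import Data.List using (tabulate)
open import Data.Fin using (Fin; toℕ)
open import Data.Integer using (ℤ; +_; _+_; _-_)
open import Data.Integer.Divisibility using (_∣_)
open import Data.Product using (Σ; ∃; ∃-syntax; _×_)
open import Relation.Binary.PropositionalEquality using (_≡_)

primePowerProduct : (K : ℕ) → (Fin K → ℕ) → (Fin K → ℕ) → ℕ
primePowerProduct K p n = product (tabulate (λ ν → p ν ^ n ν))

-- Z_M is represented by Fin M (canonical residues 0..M-1); ι is the integer representative.
ι : {M : ℕ} → Fin M → ℤ
ι x = + toℕ x

_≡[_]_ : ℤ → ℕ → ℤ → Set
x ≡[ d ] y = (+ d) ∣ (x - y)

IsDirectSum : (M : ℕ) → (Fin M → Set) → (Fin M → Set) → Set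
IsDirectSum M A B =
  (x : Fin M) →
    (∃[ a ] ∃[ b ] (A a × B b × ((ι a + ι b) ≡[ M ] ι x)))
    × ((a b a' b' : Fin M) → A a → B b → A a' → B b' →
        (ι a + ι b) ≡[ M ] ι x → (ι a' + ι b') ≡[ M ] ι x →
        (a ≡ a') × (b ≡ b'))

Λ : {M : ℕ} → Fin M → ℕ → Fin M → Set
Λ x d x' = ι x ≡[ d ] ι x'

Π : {M : ℕ} → Fin M → ℕ → Fin M → Set
Π = Λ

ΣA : {M : ℕ} → (A B Z : Fin M → Set) → Fin M → Set
ΣA {M} A B Z a = A a × ∃[ b ] (B b × ∃[ c ] (((ι a + ι b) ≡[ M ] ι c) × Z c))

ΣB : {M : ℕ} → (A B Z : Fin M → Set) → Fin M → Set
ΣB {M} A B Z b = B b × ∃[ a ] (A a × ∃[ c ] (((ι a + ι b) ≡[ M ] ι c) × Z c))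

{-# OPTIONS --safe #-}
module Submission where

-- Divisor exclusion: if a₁ + b₁ ≡ a₂ + b₂ modulo d = M/(pᵢpⱼ) with aₖ ∈ A and bₖ ∈ B, then pᵢ^(nᵢ-1)
-- or pⱼ^(nⱼ-1) divides a₁ - a₂. Otherwise some t prime to M satisfies t(a₁ - a₂) ≡ b₂ - b₁ (mod M),
-- so t·a₁ + b₁ = t·a₂ + b₂, and a₁ = a₂ by Tijdeman's theorem that the dilate tA still tiles with B.
-- Tijdeman's theorem is proved in the group semiring ℕ[ℤ_M]: for a prime q ∤ |A|, Frobenius gives
-- 𝟙_A^q ≡ 𝟙_{qA} (mod q), so every coefficient of 𝟙_{qA}·𝟙_B is ≡ |A|^(q-1) ≢ 0 (mod q); these
-- coefficients are positive and add up to |A||B| = M, hence all equal 1.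
-- For the lemma, apply divisor exclusion to (a, b) and each pair (a′, b′) with a′ + b′ ∈ Λ. If some a′
-- has pⱼ^(nⱼ-1) ∤ a - a′, then pᵢ^(nᵢ-1) ∣ a - a′, and exclusion between (a′, b′) and any other pair
-- forces pᵢ^(nᵢ-1) ∣ a - a″ throughout; the B side follows from a + b ≡ a″ + b″ (mod d).

open import Data.Nat using (ℕ; NonZero)
open import Data.Fin using (Fin)
open import Data.Product using (_×_; ∃₂)
open import Level using (0ℓ)
open import Relation.Unary using (Pred)
open import Relation.Binary.PropositionalEquality using (_≡_)
open import Algebra.Core using (Op₁; Op₂)
open import Algebra.Structures using (IsAbelianGroup)
open import Defs using (IsDirectSum)

module FiniteSums where

  open import Data.Nat
  open import Data.Nat.Properties
  open import Data.Fin as Fin using (Fin; zero; suc)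
  open import Data.Bool using (if_then_else_)
  open import Function using (const)
  open import Relation.Nullary using (Dec; does; yes; no; _×-dec_; contradiction)
  open import Relation.Binary.PropositionalEquality
  open import Algebra.Properties.Semiring.Sum +-*-semiring
    using (sum; sum-replicate-zero; sum-cong-≗; ∑-comm; *-distribˡ-sum; *-distribʳ-sum)

  iverson : ∀ {p} {P : Set p} → Dec P → ℕ
  iverson P? = if does P? then 1 else 0

  iverson≤1 : ∀ {p} {P : Set p} (P? : Dec P) → iverson P? ≤ 1
  iverson≤1 (yes _) = s≤s z≤n
  iverson≤1 (no _)  = z≤n

  iverson-yes : ∀ {p} {P : Set p} (P? : Dec P) → P → iverson P? ≡ 1
  iverson-yes (yes _) _ = refl
  iverson-yes (no ¬p) p = contradiction p ¬p

  iverson-resp : ∀ {p q} {P : Set p} {Q : Set q} (P? : Dec P) (Q? : Dec Q) →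
                 (P → Q) → (Q → P) → iverson P? ≡ iverson Q?
  iverson-resp (yes _) (yes _) _   _   = refl
  iverson-resp (no _)  (no _)  _   _   = refl
  iverson-resp (yes p) (no ¬q) p→q _   = contradiction (p→q p) ¬q
  iverson-resp (no ¬p) (yes q) _   q→p = contradiction (q→p q) ¬p

  iverson-* : ∀ {p q} {P : Set p} {Q : Set q} (P? : Dec P) (Q? : Dec Q) →
              iverson P? * iverson Q? ≡ iverson (P? ×-dec Q?)
  iverson-* (yes _) (yes _) = refl
  iverson-* (yes _) (no _)  = refl
  iverson-* (no _)  _       = refl

  δ : ∀ {n} → Fin n → Fin n → ℕ
  δ r i = iverson (r Fin.≟ i)

  δ-comm : ∀ {n} (r i : Fin n) → δ r i ≡ δ i r
  δ-comm r i = iverson-resp (r Fin.≟ i) (i Fin.≟ r) sym sym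

  sum-δ : ∀ {n} (r : Fin n) (h : Fin n → ℕ) → (sum λ i → δ r i * h i) ≡ h r
  sum-δ {suc n} zero    h = trans (cong₂ _+_ (*-identityˡ (h zero)) (sum-replicate-zero n)) (+-identityʳ (h zero))
  sum-δ {suc n} (suc r) h = sum-δ r (λ i → h (suc i))

  sum-δ-const : ∀ {n} (r : Fin n) → sum (δ r) ≡ 1
  sum-δ-const r = trans (sum-cong-≗ λ i → sym (*-identityʳ (δ r i))) (sum-δ r (const 1))

  sum-const-1 : ∀ n → sum {n} (const 1) ≡ n
  sum-const-1 zero    = refl
  sum-const-1 (suc n) = cong suc (sum-const-1 n)

  sum-*ˡ : ∀ {m} c (f : Fin m → ℕ) → (sum λ i → c * f i) ≡ c * sum f
  sum-*ˡ c f = sym (*-distribˡ-sum c f)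

  sum-*ʳ : ∀ {m} c (f : Fin m → ℕ) → (sum λ i → f i * c) ≡ sum f * c
  sum-*ʳ c f = sym (*-distribʳ-sum c f)

  ∑∑-*ˡ : ∀ {a b} c (f : Fin a → Fin b → ℕ) →
          (sum λ i → sum λ j → c * f i j) ≡ c * (sum λ i → sum λ j → f i j)
  ∑∑-*ˡ c f = trans (sum-cong-≗ λ i → sum-*ˡ c (f i)) (sum-*ˡ c λ i → sum (f i))

  ∑∑-*ʳ : ∀ {a b} c (f : Fin a → Fin b → ℕ) →
          (sum λ i → sum λ j → f i j * c) ≡ (sum λ i → sum λ j → f i j) * c
  ∑∑-*ʳ c f = trans (sum-cong-≗ λ i → sum-*ʳ c (f i)) (sum-*ʳ c λ i → sum (f i))

  ∑-sink : ∀ {a b c} (f : Fin a → Fin b → Fin c → ℕ) →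
           (sum λ i → sum λ j → sum λ k → f i j k) ≡ (sum λ j → sum λ k → sum λ i → f i j k)
  ∑-sink f = trans (∑-comm λ i j → sum (f i j)) (sum-cong-≗ λ j → ∑-comm λ i k → f i j k)

  sum-mono-≤ : ∀ {n} {f g : Fin n → ℕ} → (∀ i → f i ≤ g i) → sum f ≤ sum g
  sum-mono-≤ {zero}  _   = z≤n
  sum-mono-≤ {suc n} f≤g = +-mono-≤ (f≤g zero) (sum-mono-≤ λ i → f≤g (suc i))

  term≤sum : ∀ {n} (f : Fin n → ℕ) i → f i ≤ sum f
  term≤sum f zero    = m≤m+n (f zero) (sum λ k → f (suc k))
  term≤sum f (suc i) = ≤-trans (term≤sum (λ k → f (suc k)) i) (m≤n+m (sum λ k → f (suc k)) (f zero))

  two-terms≤sum : ∀ {n} (f : Fin n → ℕ) {i j} → i ≢ j → f i + f j ≤ sum f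
  two-terms≤sum f {zero}  {zero}  i≢j = contradiction refl i≢j
  two-terms≤sum f {zero}  {suc j} _   = +-monoʳ-≤ (f zero) (term≤sum (λ k → f (suc k)) j)
  two-terms≤sum f {suc i} {zero}  _   =
    subst (_≤ sum f) (+-comm (f zero) (f (suc i))) (+-monoʳ-≤ (f zero) (term≤sum (λ k → f (suc k)) i))
  two-terms≤sum f {suc i} {suc j} i≢j =
    ≤-trans (two-terms≤sum (λ k → f (suc k)) λ i≡j → i≢j (cong suc i≡j)) (m≤n+m (sum λ k → f (suc k)) (f zero))

  positive-sum≤length⇒≡1 : ∀ {n} (f : Fin n → ℕ) → (∀ i → 1 ≤ f i) → sum f ≤ n → ∀ i → f i ≡ 1
  positive-sum≤length⇒≡1 {suc n} f 1≤f sum≤1+n zero = ≤-antisym f₀≤1 (1≤f zero)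
    where
    n≤rest : n ≤ sum λ k → f (suc k)
    n≤rest = subst (_≤ sum λ k → f (suc k)) (sum-const-1 n) (sum-mono-≤ λ k → 1≤f (suc k))
    f₀≤1 : f zero ≤ 1
    f₀≤1 = +-cancelʳ-≤ n (f zero) 1 (≤-trans (+-monoʳ-≤ (f zero) n≤rest) sum≤1+n)
  positive-sum≤length⇒≡1 {suc n} f 1≤f sum≤1+n (suc i) =
    positive-sum≤length⇒≡1 (λ k → f (suc k)) (λ k → 1≤f (suc k)) rest≤n i
    where
    rest≤n : (sum λ k → f (suc k)) ≤ n
    rest≤n = +-cancelˡ-≤ 1 (sum λ k → f (suc k)) n (≤-trans (+-monoˡ-≤ (sum λ k → f (suc k)) (1≤f zero)) sum≤1+n)

module NatCongruence where

  open import Data.Nat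
  open import Data.Nat.Properties using (+-*-semiring)
  open import Data.Nat.DivMod using (_%_; %-distribˡ-+; %-distribˡ-*)
  open import Data.Nat.Divisibility using (_∣_; _∣0; n∣m⇒m%n≡0; m%n≡0⇒n∣m)
  open import Data.Fin using (Fin; zero; suc)
  open import Relation.Binary.PropositionalEquality
  open import Algebra.Properties.Semiring.Sum +-*-semiring using (sum)

  infix 4 _≡_[modℕ_]

  record _≡_[modℕ_] (a b q : ℕ) .{{_ : NonZero q}} : Set where
    constructor congruentℕ
    field %-≡ : a % q ≡ b % q

  module _ {q : ℕ} .{{_ : NonZero q}} where

    private
      0%q≡0 : 0 % q ≡ 0
      0%q≡0 = n∣m⇒m%n≡0 0 q (q ∣0)

    ≡-modℕ-reflexive : ∀ {a b} → a ≡ b → a ≡ b [modℕ q ]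
    ≡-modℕ-reflexive refl = congruentℕ refl

    ≡-modℕ-sym : ∀ {a b} → a ≡ b [modℕ q ] → b ≡ a [modℕ q ]
    ≡-modℕ-sym (congruentℕ a≡b) = congruentℕ (sym a≡b)

    ≡-modℕ-trans : ∀ {a b c} → a ≡ b [modℕ q ] → b ≡ c [modℕ q ] → a ≡ c [modℕ q ]
    ≡-modℕ-trans (congruentℕ a≡b) (congruentℕ b≡c) = congruentℕ (trans a≡b b≡c)

    +-cong-modℕ : ∀ {a a′ b b′} → a ≡ a′ [modℕ q ] → b ≡ b′ [modℕ q ] → a + b ≡ a′ + b′ [modℕ q ]
    +-cong-modℕ {a} {a′} {b} {b′} (congruentℕ a≡a′) (congruentℕ b≡b′) = congruentℕ (begin
      (a + b) % q                ≡⟨ %-distribˡ-+ a b q ⟩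
      (a % q + b % q) % q        ≡⟨ cong₂ (λ x y → (x + y) % q) a≡a′ b≡b′ ⟩
      (a′ % q + b′ % q) % q      ≡⟨ %-distribˡ-+ a′ b′ q ⟨
      (a′ + b′) % q              ∎)
      where open ≡-Reasoning

    *-congʳ-modℕ : ∀ c {a a′} → a ≡ a′ [modℕ q ] → a * c ≡ a′ * c [modℕ q ]
    *-congʳ-modℕ c {a} {a′} (congruentℕ a≡a′) = congruentℕ (begin
      (a * c) % q                ≡⟨ %-distribˡ-* a c q ⟩
      (a % q * (c % q)) % q      ≡⟨ cong (λ x → (x * (c % q)) % q) a≡a′ ⟩
      (a′ % q * (c % q)) % q     ≡⟨ %-distribˡ-* a′ c q ⟨
      (a′ * c) % q               ∎)
      where open ≡-Reasoning

    sum-cong-modℕ : ∀ {m} {f g : Fin m → ℕ} → (∀ i → f i ≡ g i [modℕ q ]) → sum f ≡ sum g [modℕ q ]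
    sum-cong-modℕ {zero}  _   = congruentℕ refl
    sum-cong-modℕ {suc m} f≡g = +-cong-modℕ (f≡g zero) (sum-cong-modℕ λ i → f≡g (suc i))

    ∣⇒≡0-modℕ : ∀ {a} → q ∣ a → a ≡ 0 [modℕ q ]
    ∣⇒≡0-modℕ {a} q∣a = congruentℕ (trans (n∣m⇒m%n≡0 a q q∣a) (sym 0%q≡0))

    ≡0-modℕ⇒∣ : ∀ {a} → a ≡ 0 [modℕ q ] → q ∣ a
    ≡0-modℕ⇒∣ {a} (congruentℕ a≡0) = m%n≡0⇒n∣m a q (trans a≡0 0%q≡0)

module PrimeDivisibility where

  open import Data.Nat
  open import Data.Nat.Properties
  open import Data.Nat.Divisibility
  open import Data.Nat.Primality using (Prime; euclidsLemma; ¬prime[1]; prime⇒nonZero)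
  open import Data.Nat.Combinatorics using (_C_; nCk≡n!/k![n-k]!; k![n∸k]!∣n!; nCn≡1)
  open import Data.Nat.DivMod using (m/n*n≡m)
  open import Data.Fin using (Fin; zero; suc; toℕ; fromℕ; inject₁)
  open import Data.Fin.Properties using (toℕ-inject₁; toℕ<n; toℕ-fromℕ)
  open import Data.Sum using (inj₁; inj₂)
  open import Relation.Nullary using (contradiction)
  open import Relation.Binary.PropositionalEquality
  open import Algebra.Properties.Semiring.Sum +-*-semiring using (sum; sum-init-last; sum-replicate-zero)
  open NatCongruence

  prime∤1 : ∀ {p} → Prime p → p ∤ 1
  prime∤1 p-prime p∣1 = ¬prime[1] (subst Prime (∣1⇒≡1 p∣1) p-prime)

  prime∤^ : ∀ {p a} → Prime p → p ∤ a → ∀ k → p ∤ a ^ k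
  prime∤^ p-prime _ zero = prime∤1 p-prime
  prime∤^ {a = a} p-prime p∤a (suc k) p∣a^[1+k] with euclidsLemma a (a ^ k) p-prime p∣a^[1+k]
  ... | inj₁ p∣a   = p∤a p∣a
  ... | inj₂ p∣a^k = prime∤^ p-prime p∤a k p∣a^k

  prime∣^⇒∣ : ∀ {p m} k → Prime p → p ∣ m ^ k → p ∣ m
  prime∣^⇒∣ zero p-prime p∣1 = contradiction p∣1 (prime∤1 p-prime)
  prime∣^⇒∣ {m = m} (suc k) p-prime p∣m^[1+k] with euclidsLemma m (m ^ k) p-prime p∣m^[1+k]
  ... | inj₁ p∣m   = p∣m
  ... | inj₂ p∣m^k = prime∣^⇒∣ k p-prime p∣m^k

  private
    n∣n! : ∀ n .{{_ : NonZero n}} → n ∣ n !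
    n∣n! (suc n) = ∣m⇒∣m*n (n !) ∣-refl

  prime∤! : ∀ {p} → Prime p → ∀ {m} → m < p → p ∤ m !
  prime∤! p-prime {zero}  _ = prime∤1 p-prime
  prime∤! p-prime {suc m} m<p p∣m! with euclidsLemma (suc m) (m !) p-prime p∣m!
  ... | inj₁ p∣1+m = >⇒∤ m<p p∣1+m
  ... | inj₂ p∣m!  = prime∤! p-prime (<-trans (n<1+n m) m<p) p∣m!

  prime∣C : ∀ {p k} → Prime p → 0 < k → k < p → p ∣ p C k
  prime∣C {p} {k} p-prime 0<k k<p with euclidsLemma (p C k) (k ! * (p ∸ k) !) p-prime p∣C*k!*[p-k]!
    where
    instance _ = prime⇒nonZero p-prime
    instance _ = m*n≢0 (k !) ((p ∸ k) !) {{k !≢0}} {{(p ∸ k) !≢0}}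
    p∣C*k!*[p-k]! : p ∣ (p C k) * (k ! * (p ∸ k) !)
    p∣C*k!*[p-k]! = subst (p ∣_) (sym (begin
      (p C k) * (k ! * (p ∸ k) !)                       ≡⟨ cong (_* (k ! * (p ∸ k) !)) (nCk≡n!/k![n-k]! (<⇒≤ k<p)) ⟩
      (p ! / (k ! * (p ∸ k) !)) * (k ! * (p ∸ k) !)     ≡⟨ m/n*n≡m (k![n∸k]!∣n! (<⇒≤ k<p)) ⟩
      p !                                               ∎)) (n∣n! p)
      where open ≡-Reasoning
  ... | inj₁ p∣C = p∣C
  ... | inj₂ p∣k!*[p-k]! with euclidsLemma (k !) ((p ∸ k) !) p-prime p∣k!*[p-k]!
  ...   | inj₁ p∣k!     = contradiction p∣k! (prime∤! p-prime k<p)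
  ...   | inj₂ p∣[p-k]! = contradiction p∣[p-k]! (prime∤! p-prime (∸-monoʳ-< 0<k (<⇒≤ k<p)))

  -- p divides every inner binomial coefficient p C k, 0 < k < p.
  binomial-sum-modℕ : ∀ {p} .{{_ : NonZero p}} → Prime p → (h : Fin (suc p) → ℕ) →
                      (sum λ k → (p C toℕ k) * h k) ≡ h zero + h (fromℕ p) [modℕ p ]
  binomial-sum-modℕ {suc p} p-prime h = ≡-modℕ-trans (≡-modℕ-reflexive split)
    (+-cong-modℕ (≡-modℕ-reflexive (refl {x = h zero})) (+-cong-modℕ inner≡0 outer≡))
    where
    term : Fin (suc (suc p)) → ℕ
    term k = (suc p C toℕ k) * h k
    split : sum term ≡ h zero + ((sum λ k → term (suc (inject₁ k))) + term (fromℕ (suc p)))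
    split = cong₂ _+_ (+-identityʳ (h zero)) (sum-init-last λ k → term (suc k))
    inner≡0 : (sum λ k → term (suc (inject₁ k))) ≡ 0 [modℕ suc p ]
    inner≡0 = ≡-modℕ-trans
      (sum-cong-modℕ λ k → ∣⇒≡0-modℕ (∣m⇒∣m*n (h (suc (inject₁ k)))
        (prime∣C p-prime z<s (s<s (subst (_< p) (sym (toℕ-inject₁ k)) (toℕ<n k))))))
      (≡-modℕ-reflexive (sum-replicate-zero p))
    outer≡ : term (fromℕ (suc p)) ≡ h (fromℕ (suc p)) [modℕ suc p ]
    outer≡ = ≡-modℕ-reflexive (begin
      (suc p C toℕ (fromℕ (suc p))) * h (fromℕ (suc p))
        ≡⟨ cong (λ k → (suc p C k) * h (fromℕ (suc p))) (toℕ-fromℕ (suc p)) ⟩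
      (suc p C suc p) * h (fromℕ (suc p))
        ≡⟨ cong (_* h (fromℕ (suc p))) (nCn≡1 (suc p)) ⟩
      1 * h (fromℕ (suc p))
        ≡⟨ *-identityˡ (h (fromℕ (suc p))) ⟩
      h (fromℕ (suc p)) ∎)
      where open ≡-Reasoning

module Congruence where

  open import Data.Nat as ℕ using (ℕ)
  import Data.Nat.Divisibility as ℕ
  open import Data.Integer
  open import Data.Integer.Properties
  open import Data.Integer.Divisibility.Signed
  open import Data.Integer.Solver using (module +-*-Solver)
  open import Relation.Binary.Bundles using (Setoid)
  open import Relation.Binary.Structures using (IsEquivalence)
  open import Relation.Binary.PropositionalEquality
  open import Relation.Nullary using (Dec; map′)
  open import Defs using (_≡[_]_)
  open +-*-Solver

  infix 4 _≡_[mod_] _≡?_[mod_]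

  -- A record, so that both sides and the modulus can be inferred from a proof.
  record _≡_[mod_] (x y : ℤ) (d : ℕ) : Set where
    constructor congruent
    field divides-difference : + d ∣ x - y

  open _≡_[mod_] public

  _≡?_[mod_] : ∀ x y d → Dec (x ≡ y [mod d ])
  x ≡? y [mod d ] = map′ congruent divides-difference (+ d ∣? x - y)

  fromDefs : ∀ {d} x y → x ≡[ d ] y → x ≡ y [mod d ]
  fromDefs x y d∣x-y = congruent (∣ᵤ⇒∣ d∣x-y)

  toDefs : ∀ {d x y} → x ≡ y [mod d ] → x ≡[ d ] y
  toDefs (congruent d∣x-y) = ∣⇒∣ᵤ d∣x-y

  module _ {d : ℕ} where

    ≡-mod-refl : ∀ {x} → x ≡ x [mod d ]
    ≡-mod-refl {x} = congruent (subst (+ d ∣_) (sym (+-inverseʳ x)) (divides 0ℤ refl))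

    ≡-mod-sym : ∀ {x y} → x ≡ y [mod d ] → y ≡ x [mod d ]
    ≡-mod-sym {x} {y} (congruent d∣x-y) = congruent
      (subst (+ d ∣_) (solve 2 (λ x y → :- (x :- y) := y :- x) refl x y) (∣m⇒∣-m d∣x-y))

    ≡-mod-trans : ∀ {x y z} → x ≡ y [mod d ] → y ≡ z [mod d ] → x ≡ z [mod d ]
    ≡-mod-trans {x} {y} {z} (congruent d∣x-y) (congruent d∣y-z) = congruent
      (subst (+ d ∣_) (solve 3 (λ x y z → (x :- y) :+ (y :- z) := x :- z) refl x y z) (∣m∣n⇒∣m+n d∣x-y d∣y-z))

    ≡-mod-isEquivalence : IsEquivalence (λ x y → x ≡ y [mod d ])
    ≡-mod-isEquivalence = record { refl = ≡-mod-refl ; sym = ≡-mod-sym ; trans = ≡-mod-trans }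

    +-cong-mod : ∀ {x x′ y y′} → x ≡ x′ [mod d ] → y ≡ y′ [mod d ] → x + y ≡ x′ + y′ [mod d ]
    +-cong-mod {x} {x′} {y} {y′} (congruent d∣x-x′) (congruent d∣y-y′) = congruent (subst (+ d ∣_)
      (solve 4 (λ x x′ y y′ → (x :- x′) :+ (y :- y′) := (x :+ y) :- (x′ :+ y′)) refl x x′ y y′)
      (∣m∣n⇒∣m+n d∣x-x′ d∣y-y′))

    +-congˡ-mod : ∀ x {y y′} → y ≡ y′ [mod d ] → x + y ≡ x + y′ [mod d ]
    +-congˡ-mod x = +-cong-mod (≡-mod-refl {x})

    +-congʳ-mod : ∀ y {x x′} → x ≡ x′ [mod d ] → x + y ≡ x′ + y [mod d ]
    +-congʳ-mod y x≡x′ = +-cong-mod x≡x′ (≡-mod-refl {y})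

    *-congˡ-mod : ∀ c {x y} → x ≡ y [mod d ] → c * x ≡ c * y [mod d ]
    *-congˡ-mod c {x} {y} (congruent d∣x-y) = congruent
      (subst (+ d ∣_) (solve 3 (λ c x y → c :* (x :- y) := c :* x :- c :* y) refl c x y) (∣n⇒∣m*n c d∣x-y))

    *-congʳ-mod : ∀ c {x y} → x ≡ y [mod d ] → x * c ≡ y * c [mod d ]
    *-congʳ-mod c {x} {y} x≡y = subst₂ (λ u v → u ≡ v [mod d ]) (*-comm c x) (*-comm c y) (*-congˡ-mod c x≡y)

    +-cancelˡ-mod : ∀ {x y x′ y′} → x + y ≡ x′ + y′ [mod d ] → x ≡ x′ [mod d ] → y ≡ y′ [mod d ]
    +-cancelˡ-mod {x} {y} {x′} {y′} (congruent d∣sums) (congruent d∣x-x′) = congruent (subst (+ d ∣_)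
      (solve 4 (λ x y x′ y′ → (x :+ y :- (x′ :+ y′)) :- (x :- x′) := y :- y′) refl x y x′ y′)
      (∣m∣n⇒∣m-n d∣sums d∣x-x′))

    +-multiple-mod : ∀ x k → x + k * + d ≡ x [mod d ]
    +-multiple-mod x k = congruent (divides k (solve 3 (λ x k d → x :+ k :* d :- x := k :* d) refl x k (+ d)))

  ≡-mod-setoid : ℕ → Setoid _ _
  ≡-mod-setoid d = record { isEquivalence = ≡-mod-isEquivalence {d} }

  ≡-mod-weaken : ∀ {d d′ x y} → d ℕ.∣ d′ → x ≡ y [mod d′ ] → x ≡ y [mod d ]
  ≡-mod-weaken {d} (ℕ.divides q refl) (congruent qd∣x-y) =
    congruent (∣-trans (divides (+ q) (pos-* q d)) qd∣x-y)

  *-scale-mod : ∀ c {k x y} → x ≡ y [mod k ] → + c * x ≡ + c * y [mod c ℕ.* k ]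
  *-scale-mod c {k} {x} {y} (congruent (divides q x-y≡qk)) = congruent (divides q (begin
    + c * x - + c * y     ≡⟨ solve 3 (λ c x y → c :* x :- c :* y := c :* (x :- y)) refl (+ c) x y ⟩
    + c * (x - y)         ≡⟨ cong (+ c *_) x-y≡qk ⟩
    + c * (q * + k)       ≡⟨ solve 3 (λ c q k → c :* (q :* k) := q :* (c :* k)) refl (+ c) q (+ k) ⟩
    q * (+ c * + k)       ≡⟨ cong (q *_) (pos-* c k) ⟨
    q * + (c ℕ.* k)       ∎))
    where open ≡-Reasoning

module GroupSemiring {n : ℕ} {_∙_ : Op₂ (Fin n)} {ε : Fin n} {_⁻¹ : Op₁ (Fin n)}
                     (isAbelianGroup : IsAbelianGroup _≡_ _∙_ ε _⁻¹) where

  open import Data.Nat hiding (_≟_)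
  open import Data.Nat.Properties hiding (_≟_)
  open import Data.Nat.Solver using (module +-*-Solver)
  open import Data.Nat.Primality using (Prime; prime⇒nonZero)
  open import Data.Nat.Combinatorics using (_C_)
  open import Data.Fin using (zero; suc; toℕ; fromℕ)
  open import Data.Fin.Properties using (_≟_; toℕ-fromℕ)
  open import Data.Product using (_,_)
  open import Function using (const)
  open import Algebra.Bundles using (CommutativeSemiring; Group)
  open import Algebra.Structures.Biased using (IsCommutativeSemiringˡ)
  import Algebra.Construct.Pointwise as Pointwise
  open import Algebra.Properties.Semiring.Sum +-*-semiring using (sum; sum-cong-≗; sum-replicate-zero; ∑-comm; ∑-distrib-+)
  open import Relation.Binary.PropositionalEquality
  open +-*-Solver using (solve; _:*_; _:+_; _:=_)
  open ≡-Reasoning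
  open FiniteSums
  open NatCongruence
  open PrimeDivisibility using (binomial-sum-modℕ)

  private
    module G = IsAbelianGroup isAbelianGroup
    group : Group _ _
    group = record { isGroup = G.isGroup }

  open Group group using (_\\_)
  open import Algebra.Properties.Group group using (\\-leftDividesˡ; \\-leftDividesʳ)
  open import Algebra.Definitions.RawMonoid (Group.rawMonoid group) public using () renaming (_×_ to _×ᵍ_)
  open import Algebra.Properties.Monoid.Mult (Group.monoid group) public
    using () renaming (×-homo-1 to ×ᵍ-homo-1; ×-assocˡ to ×ᵍ-assocˡ)

  ℕ[G] : Set
  ℕ[G] = Fin n → ℕ

  infixl 6 _+ᴳ_
  infixl 7 _*ᴳ_

  _+ᴳ_ : ℕ[G] → ℕ[G] → ℕ[G]
  (u +ᴳ v) s = u s + v s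

  _*ᴳ_ : ℕ[G] → ℕ[G] → ℕ[G]
  (u *ᴳ v) s = sum λ x → sum λ y → u x * v y * δ (x ∙ y) s

  0ᴳ 1ᴳ : ℕ[G]
  0ᴳ = const 0
  1ᴳ = δ ε

  *ᴳ-cong : ∀ {u u′ v v′} → u ≗ u′ → v ≗ v′ → u *ᴳ v ≗ u′ *ᴳ v′
  *ᴳ-cong u≗u′ v≗v′ s =
    sum-cong-≗ λ x → sum-cong-≗ λ y → cong₂ (λ a b → a * b * δ (x ∙ y) s) (u≗u′ x) (v≗v′ y)

  *ᴳ-comm : ∀ u v → u *ᴳ v ≗ v *ᴳ u
  *ᴳ-comm u v s = trans (∑-comm λ x y → u x * v y * δ (x ∙ y) s) (sum-cong-≗ λ y → sum-cong-≗ λ x →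
    cong₂ _*_ (*-comm (u x) (v y)) (cong (λ g → δ g s) (G.comm x y)))

  *ᴳ-zeroˡ : ∀ u → 0ᴳ *ᴳ u ≗ 0ᴳ
  *ᴳ-zeroˡ u s = trans (sum-cong-≗ {n} λ _ → sum-replicate-zero n) (sum-replicate-zero n)

  *ᴳ-distribʳ : ∀ u v w → (v +ᴳ w) *ᴳ u ≗ v *ᴳ u +ᴳ w *ᴳ u
  *ᴳ-distribʳ u v w s = begin
    (sum λ x → sum λ y → (v x + w x) * u y * δ (x ∙ y) s)
      ≡⟨ (sum-cong-≗ λ x → sum-cong-≗ λ y → distrib (v x) (w x) (u y) (δ (x ∙ y) s)) ⟩
    (sum λ x → sum λ y → v x * u y * δ (x ∙ y) s + w x * u y * δ (x ∙ y) s)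
      ≡⟨ (sum-cong-≗ λ x → ∑-distrib-+ (λ y → v x * u y * δ (x ∙ y) s) (λ y → w x * u y * δ (x ∙ y) s)) ⟩
    (sum λ x → (sum λ y → v x * u y * δ (x ∙ y) s) + (sum λ y → w x * u y * δ (x ∙ y) s))
      ≡⟨ ∑-distrib-+ (λ x → sum λ y → v x * u y * δ (x ∙ y) s) (λ x → sum λ y → w x * u y * δ (x ∙ y) s) ⟩
    (v *ᴳ u) s + (w *ᴳ u) s ∎
    where
    distrib : ∀ a b c d → (a + b) * c * d ≡ a * c * d + b * c * d
    distrib = solve 4 (λ a b c d → (a :+ b) :* c :* d := a :* c :* d :+ b :* c :* d) refl

  *ᴳ-identityˡ : ∀ v → 1ᴳ *ᴳ v ≗ v
  *ᴳ-identityˡ v s = begin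
    (sum λ x → sum λ y → δ ε x * v y * δ (x ∙ y) s)
      ≡⟨ (sum-cong-≗ λ x → trans (sum-cong-≗ λ y → *-assoc (δ ε x) (v y) (δ (x ∙ y) s))
                                 (sum-*ˡ (δ ε x) λ y → v y * δ (x ∙ y) s)) ⟩
    (sum λ x → δ ε x * sum λ y → v y * δ (x ∙ y) s)
      ≡⟨ sum-δ ε (λ x → sum λ y → v y * δ (x ∙ y) s) ⟩
    (sum λ y → v y * δ (ε ∙ y) s)
      ≡⟨ (sum-cong-≗ λ y → trans (*-comm (v y) (δ (ε ∙ y) s))
                                 (cong (_* v y) (trans (cong (λ g → δ g s) (G.identityˡ y)) (δ-comm y s)))) ⟩
    (sum λ y → δ s y * v y)
      ≡⟨ sum-δ s v ⟩
    v s ∎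

  private
    *ᴳ-assoc-expandˡ : ∀ u v w s →
      ((u *ᴳ v) *ᴳ w) s ≡ (sum λ x → sum λ y → sum λ z → u x * v y * w z * δ ((x ∙ y) ∙ z) s)
    *ᴳ-assoc-expandˡ u v w s = begin
      (sum λ r → sum λ z → (u *ᴳ v) r * w z * δ (r ∙ z) s)
        ≡⟨ (sum-cong-≗ λ r → sum-cong-≗ λ z → trans (*-assoc ((u *ᴳ v) r) (w z) (δ (r ∙ z) s))
             (sym (∑∑-*ʳ (w z * δ (r ∙ z) s) λ x y → u x * v y * δ (x ∙ y) r))) ⟩
      (sum λ r → sum λ z → sum λ x → sum λ y → u x * v y * δ (x ∙ y) r * (w z * δ (r ∙ z) s))
        ≡⟨ trans (∑-comm λ r z → sum λ x → sum λ y → u x * v y * δ (x ∙ y) r * (w z * δ (r ∙ z) s))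
                 (sum-cong-≗ λ z → ∑-sink λ r x y → u x * v y * δ (x ∙ y) r * (w z * δ (r ∙ z) s)) ⟩
      (sum λ z → sum λ x → sum λ y → sum λ r → u x * v y * δ (x ∙ y) r * (w z * δ (r ∙ z) s))
        ≡⟨ ∑-sink (λ z x y → sum λ r → u x * v y * δ (x ∙ y) r * (w z * δ (r ∙ z) s)) ⟩
      (sum λ x → sum λ y → sum λ z → sum λ r → u x * v y * δ (x ∙ y) r * (w z * δ (r ∙ z) s))
        ≡⟨ (sum-cong-≗ λ x → sum-cong-≗ λ y → sum-cong-≗ λ z → trans
             (sum-cong-≗ λ r → shuffle (u x * v y) (δ (x ∙ y) r) (w z) (δ (r ∙ z) s))
             (sum-δ (x ∙ y) λ r → u x * v y * w z * δ (r ∙ z) s)) ⟩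
      (sum λ x → sum λ y → sum λ z → u x * v y * w z * δ ((x ∙ y) ∙ z) s) ∎
      where
      shuffle : ∀ a b c d → a * b * (c * d) ≡ b * (a * c * d)
      shuffle = solve 4 (λ a b c d → a :* b :* (c :* d) := b :* (a :* c :* d)) refl

    *ᴳ-assoc-expandʳ : ∀ u v w s →
      (u *ᴳ (v *ᴳ w)) s ≡ (sum λ x → sum λ y → sum λ z → u x * v y * w z * δ (x ∙ (y ∙ z)) s)
    *ᴳ-assoc-expandʳ u v w s = begin
      (sum λ x → sum λ r → u x * (v *ᴳ w) r * δ (x ∙ r) s)
        ≡⟨ (sum-cong-≗ λ x → sum-cong-≗ λ r → trans (swap (u x) ((v *ᴳ w) r) (δ (x ∙ r) s))
             (sym (∑∑-*ˡ (u x * δ (x ∙ r) s) λ y z → v y * w z * δ (y ∙ z) r))) ⟩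
      (sum λ x → sum λ r → sum λ y → sum λ z → u x * δ (x ∙ r) s * (v y * w z * δ (y ∙ z) r))
        ≡⟨ (sum-cong-≗ λ x → ∑-sink λ r y z → u x * δ (x ∙ r) s * (v y * w z * δ (y ∙ z) r)) ⟩
      (sum λ x → sum λ y → sum λ z → sum λ r → u x * δ (x ∙ r) s * (v y * w z * δ (y ∙ z) r))
        ≡⟨ (sum-cong-≗ λ x → sum-cong-≗ λ y → sum-cong-≗ λ z → trans
             (sum-cong-≗ λ r → shuffle (u x) (δ (x ∙ r) s) (v y) (w z) (δ (y ∙ z) r))
             (sum-δ (y ∙ z) λ r → u x * v y * w z * δ (x ∙ r) s)) ⟩
      (sum λ x → sum λ y → sum λ z → u x * v y * w z * δ (x ∙ (y ∙ z)) s) ∎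
      where
      swap : ∀ a b c → a * b * c ≡ a * c * b
      swap = solve 3 (λ a b c → a :* b :* c := a :* c :* b) refl
      shuffle : ∀ a b c c′ d → a * b * (c * c′ * d) ≡ d * (a * c * c′ * b)
      shuffle = solve 5 (λ a b c c′ d → a :* b :* (c :* c′ :* d) := d :* (a :* c :* c′ :* b)) refl

  *ᴳ-assoc : ∀ u v w → (u *ᴳ v) *ᴳ w ≗ u *ᴳ (v *ᴳ w)
  *ᴳ-assoc u v w s = begin
    ((u *ᴳ v) *ᴳ w) s
      ≡⟨ *ᴳ-assoc-expandˡ u v w s ⟩
    (sum λ x → sum λ y → sum λ z → u x * v y * w z * δ ((x ∙ y) ∙ z) s)
      ≡⟨ (sum-cong-≗ λ x → sum-cong-≗ λ y → sum-cong-≗ λ z →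
           cong (λ g → u x * v y * w z * δ g s) (G.assoc x y z)) ⟩
    (sum λ x → sum λ y → sum λ z → u x * v y * w z * δ (x ∙ (y ∙ z)) s)
      ≡⟨ *ᴳ-assoc-expandʳ u v w s ⟨
    (u *ᴳ (v *ᴳ w)) s ∎

  commutativeSemiring : CommutativeSemiring _ _
  commutativeSemiring = record
    { isCommutativeSemiring = IsCommutativeSemiringˡ.isCommutativeSemiring record
      { +-isCommutativeMonoid = Pointwise.isCommutativeMonoid (Fin n) +-0-isCommutativeMonoid
      ; *-isCommutativeMonoid = record
        { isMonoid = record
          { isSemigroup = record
            { isMagma = record { isEquivalence = Pointwise.isEquivalence (Fin n) isEquivalence ; ∙-cong = *ᴳ-cong }
            ; assoc = *ᴳ-assoc }
          ; identity = *ᴳ-identityˡ , λ u s → trans (*ᴳ-comm u 1ᴳ s) (*ᴳ-identityˡ u s) }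
        ; comm = *ᴳ-comm }
      ; distribʳ = *ᴳ-distribʳ
      ; zeroˡ = *ᴳ-zeroˡ } }

  open import Algebra.Properties.Semiring.Exp (CommutativeSemiring.semiring commutativeSemiring) public
    using (^-congˡ) renaming (_^_ to _^ᴳ_)

  sum-*ᴳ : ∀ u v → sum (u *ᴳ v) ≡ sum u * sum v
  sum-*ᴳ u v = begin
    (sum λ s → sum λ x → sum λ y → u x * v y * δ (x ∙ y) s)
      ≡⟨ ∑-sink (λ s x y → u x * v y * δ (x ∙ y) s) ⟩
    (sum λ x → sum λ y → sum λ s → u x * v y * δ (x ∙ y) s)
      ≡⟨ (sum-cong-≗ λ x → sum-cong-≗ λ y → trans (sum-*ˡ (u x * v y) (δ (x ∙ y)))
           (trans (cong (u x * v y *_) (sum-δ-const (x ∙ y))) (*-identityʳ (u x * v y)))) ⟩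
    (sum λ x → sum λ y → u x * v y)
      ≡⟨ (sum-cong-≗ λ x → sum-*ˡ (u x) v) ⟩
    (sum λ x → u x * sum v)
      ≡⟨ sum-*ʳ (sum v) u ⟩
    sum u * sum v ∎

  sum-^ᴳ : ∀ u k → sum (u ^ᴳ k) ≡ sum u ^ k
  sum-^ᴳ u zero    = sum-δ-const ε
  sum-^ᴳ u (suc k) = trans (sum-*ᴳ u (u ^ᴳ k)) (cong (sum u *_) (sum-^ᴳ u k))

  sum-δ-translate : ∀ x s → (sum λ y → δ (x ∙ y) s) ≡ 1
  sum-δ-translate x s =
    trans (sum-cong-≗ λ y → iverson-resp (x ∙ y ≟ s) (x \\ s ≟ y) solved solution) (sum-δ-const (x \\ s))
    where
    solved : ∀ {y} → x ∙ y ≡ s → x \\ s ≡ y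
    solved {y} refl = \\-leftDividesʳ x y
    solution : ∀ {y} → x \\ s ≡ y → x ∙ y ≡ s
    solution refl = \\-leftDividesˡ x s

  *ᴳ-const : ∀ u c → u *ᴳ const c ≗ const (sum u * c)
  *ᴳ-const u c s = begin
    (sum λ x → sum λ y → u x * c * δ (x ∙ y) s)
      ≡⟨ (sum-cong-≗ λ x → trans (sum-*ˡ (u x * c) λ y → δ (x ∙ y) s)
           (trans (cong (u x * c *_) (sum-δ-translate x s)) (*-identityʳ (u x * c)))) ⟩
    (sum λ x → u x * c)
      ≡⟨ sum-*ʳ c u ⟩
    sum u * c ∎

  δ-*ᴳ-δ : ∀ a b → δ a *ᴳ δ b ≗ δ (a ∙ b)
  δ-*ᴳ-δ a b s = begin
    (sum λ x → sum λ y → δ a x * δ b y * δ (x ∙ y) s)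
      ≡⟨ (sum-cong-≗ λ x → trans (sum-cong-≗ λ y → *-assoc (δ a x) (δ b y) (δ (x ∙ y) s))
                                 (sum-*ˡ (δ a x) λ y → δ b y * δ (x ∙ y) s)) ⟩
    (sum λ x → δ a x * sum λ y → δ b y * δ (x ∙ y) s)
      ≡⟨ sum-δ a (λ x → sum λ y → δ b y * δ (x ∙ y) s) ⟩
    (sum λ y → δ b y * δ (a ∙ y) s)
      ≡⟨ sum-δ b (λ y → δ (a ∙ y) s) ⟩
    δ (a ∙ b) s ∎

  δ-^ᴳ : ∀ a k → δ a ^ᴳ k ≗ δ (k ×ᵍ a)
  δ-^ᴳ a zero    s = refl
  δ-^ᴳ a (suc k) s = trans (*ᴳ-cong {δ a} (λ _ → refl) (δ-^ᴳ a k) s) (δ-*ᴳ-δ a (k ×ᵍ a) s)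

  pushforward : ∀ {m} → (Fin m → Fin n) → (Fin m → ℕ) → ℕ[G]
  pushforward g u s = sum λ x → u x * δ (g x) s

  sum-pushforward : ∀ {m} (g : Fin m → Fin n) u → sum (pushforward g u) ≡ sum u
  sum-pushforward g u = begin
    (sum λ s → sum λ x → u x * δ (g x) s)
      ≡⟨ ∑-comm (λ s x → u x * δ (g x) s) ⟩
    (sum λ x → sum λ s → u x * δ (g x) s)
      ≡⟨ (sum-cong-≗ λ x → trans (sum-*ˡ (u x) (δ (g x)))
           (trans (cong (u x *_) (sum-δ-const (g x))) (*-identityʳ (u x)))) ⟩
    sum u ∎

  pushforward-*ᴳ : ∀ {m} (g : Fin m → Fin n) u v s →
                   (pushforward g u *ᴳ v) s ≡ (sum λ x → u x * sum λ y → v y * δ (g x ∙ y) s)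
  pushforward-*ᴳ g u v s = begin
    (sum λ r → sum λ y → pushforward g u r * v y * δ (r ∙ y) s)
      ≡⟨ (sum-cong-≗ λ r → sum-cong-≗ λ y → trans (*-assoc (pushforward g u r) (v y) (δ (r ∙ y) s))
           (sym (sum-*ʳ (v y * δ (r ∙ y) s) λ x → u x * δ (g x) r))) ⟩
    (sum λ r → sum λ y → sum λ x → u x * δ (g x) r * (v y * δ (r ∙ y) s))
      ≡⟨ trans (sum-cong-≗ λ r → ∑-comm λ y x → u x * δ (g x) r * (v y * δ (r ∙ y) s))
               (∑-sink λ r x y → u x * δ (g x) r * (v y * δ (r ∙ y) s)) ⟩
    (sum λ x → sum λ y → sum λ r → u x * δ (g x) r * (v y * δ (r ∙ y) s))
      ≡⟨ (sum-cong-≗ λ x → sum-cong-≗ λ y → trans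
           (sum-cong-≗ λ r → shuffle (u x) (δ (g x) r) (v y * δ (r ∙ y) s))
           (sum-δ (g x) λ r → u x * (v y * δ (r ∙ y) s))) ⟩
    (sum λ x → sum λ y → u x * (v y * δ (g x ∙ y) s))
      ≡⟨ (sum-cong-≗ λ x → sum-*ˡ (u x) λ y → v y * δ (g x ∙ y) s) ⟩
    (sum λ x → u x * sum λ y → v y * δ (g x ∙ y) s) ∎
    where
    shuffle : ∀ a b c → a * b * c ≡ b * (a * c)
    shuffle = solve 3 (λ a b c → a :* b :* c := b :* (a :* c)) refl

  *ᴳ-congˡ-modℕ : ∀ {q} .{{_ : NonZero q}} {u u′} v → (∀ x → u x ≡ u′ x [modℕ q ]) →
                  ∀ s → (u *ᴳ v) s ≡ (u′ *ᴳ v) s [modℕ q ]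
  *ᴳ-congˡ-modℕ v u≡u′ s =
    sum-cong-modℕ λ x → sum-cong-modℕ λ y → *-congʳ-modℕ (δ (x ∙ y) s) (*-congʳ-modℕ (v y) (u≡u′ x))

  module _ (q : ℕ) (q-prime : Prime q) where

    private
      instance _ = prime⇒nonZero q-prime
      module ℕ[G] = CommutativeSemiring commutativeSemiring
      open import Algebra.Definitions.RawMonoid ℕ[G].+-rawMonoid using () renaming (sum to sumᴳ; _×_ to _×ᴳ_)
      open import Algebra.Properties.CommutativeSemiring.Binomial commutativeSemiring using (theorem; binomial)

      sumᴳ-at : ∀ {m} (t : Fin m → ℕ[G]) s → sumᴳ t s ≡ sum λ k → t k s
      sumᴳ-at {zero}  t s = refl
      sumᴳ-at {suc m} t s = cong (t zero s +_) (sumᴳ-at (λ k → t (suc k)) s)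

      ×ᴳ-at : ∀ c u s → (c ×ᴳ u) s ≡ c * u s
      ×ᴳ-at zero    u s = refl
      ×ᴳ-at (suc c) u s = cong (u s +_) (×ᴳ-at c u s)

      0ᴳ-^ᴳ : ∀ k → .{{NonZero k}} → 0ᴳ ^ᴳ k ≗ 0ᴳ
      0ᴳ-^ᴳ (suc k) = *ᴳ-zeroˡ (0ᴳ ^ᴳ k)

    ^ᴳ-+ᴳ-modℕ : ∀ u v s → ((u +ᴳ v) ^ᴳ q) s ≡ (u ^ᴳ q) s + (v ^ᴳ q) s [modℕ q ]
    ^ᴳ-+ᴳ-modℕ u v s = ≡-modℕ-trans (≡-modℕ-reflexive expand)
      (≡-modℕ-trans (binomial-sum-modℕ q-prime h) (≡-modℕ-reflexive ends))
      where
      h : Fin (suc q) → ℕ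
      h k = binomial u v q k s
      expand : ((u +ᴳ v) ^ᴳ q) s ≡ sum λ k → (q C toℕ k) * h k
      expand = trans (theorem q u v s) (trans (sumᴳ-at (λ k → (q C toℕ k) ×ᴳ binomial u v q k) s)
                                              (sum-cong-≗ λ k → ×ᴳ-at (q C toℕ k) (binomial u v q k) s))
      last-term : h (fromℕ q) ≡ (u ^ᴳ q) s
      last-term = begin
        ((u ^ᴳ toℕ (fromℕ q)) *ᴳ (v ^ᴳ (q ∸ toℕ (fromℕ q)))) s
          ≡⟨ cong (λ k → ((u ^ᴳ k) *ᴳ (v ^ᴳ (q ∸ k))) s) (toℕ-fromℕ q) ⟩
        ((u ^ᴳ q) *ᴳ (v ^ᴳ (q ∸ q))) s
          ≡⟨ cong (λ k → ((u ^ᴳ q) *ᴳ (v ^ᴳ k)) s) (n∸n≡0 q) ⟩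
        ((u ^ᴳ q) *ᴳ 1ᴳ) s
          ≡⟨ ℕ[G].*-identityʳ (u ^ᴳ q) s ⟩
        (u ^ᴳ q) s ∎
      ends : h zero + h (fromℕ q) ≡ (u ^ᴳ q) s + (v ^ᴳ q) s
      ends = trans (+-comm (h zero) (h (fromℕ q))) (cong₂ _+_ last-term (*ᴳ-identityˡ (v ^ᴳ q) s))

    pushforward-^ᴳ-modℕ : ∀ {m} (g : Fin m → Fin n) u → (∀ x → u x ≤ 1) →
                          ∀ s → (pushforward g u ^ᴳ q) s ≡ pushforward (λ x → q ×ᵍ g x) u s [modℕ q ]
    pushforward-^ᴳ-modℕ {zero}  g u _   s = ≡-modℕ-reflexive (0ᴳ-^ᴳ q s)
    pushforward-^ᴳ-modℕ {suc m} g u u≤1 s = ≡-modℕ-trans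
      (^ᴳ-+ᴳ-modℕ (λ s → u zero * δ (g zero) s) (pushforward (λ x → g (suc x)) (λ x → u (suc x))) s)
      (+-cong-modℕ (≡-modℕ-reflexive (first-^ᴳ (u zero) (u≤1 zero)))
                   (pushforward-^ᴳ-modℕ (λ x → g (suc x)) (λ x → u (suc x)) (λ x → u≤1 (suc x)) s))
      where
      first-^ᴳ : ∀ c → c ≤ 1 → ((λ s → c * δ (g zero) s) ^ᴳ q) s ≡ c * δ (q ×ᵍ g zero) s
      first-^ᴳ zero          _        = 0ᴳ-^ᴳ q s
      first-^ᴳ (suc zero)    _        = trans (^-congˡ q (λ s → *-identityˡ (δ (g zero) s)) s)
                                              (trans (δ-^ᴳ (g zero) q s) (sym (*-identityˡ (δ (q ×ᵍ g zero) s))))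
      first-^ᴳ (suc (suc _)) (s≤s ())

module Tiling {n : ℕ} {_∙_ : Op₂ (Fin n)} {ε : Fin n} {_⁻¹ : Op₁ (Fin n)}
              (isAbelianGroup : IsAbelianGroup _≡_ _∙_ ε _⁻¹) {A B : Pred (Fin n) 0ℓ}
              (factor : ∀ s → ∃₂ λ x y → A x × B y × x ∙ y ≡ s)
              (factor-unique : ∀ {x y x′ y′} → A x → B y → A x′ → B y′ →
                               x ∙ y ≡ x′ ∙ y′ → x ≡ x′ × y ≡ y′)
              where

  open import Data.Nat hiding (_≟_)
  open import Data.Nat.Properties hiding (_≟_)
  open import Data.Nat.Divisibility using (_∣_; _∤_)
  open import Data.Nat.Primality using (Prime; prime⇒nonZero)
  open import Data.Nat.Primality.Factorisation using (PrimeFactorisation; factorise)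
  open import Data.Nat.ListAction using (product)
  open import Data.Nat.ListAction.Properties using (∈⇒∣product)
  open import Data.Fin.Properties using (_≟_)
  open import Data.Product using (_,_; proj₁; proj₂)
  open import Data.List using ([]; _∷_)
  open import Data.List.Membership.Propositional using (_∈_)
  open import Data.List.Relation.Unary.All as All using (All; []; _∷_)
  open import Data.List.Relation.Unary.Any using (here; there)
  open import Function using (const)
  open import Relation.Unary using (Decidable)
  open import Relation.Nullary using (map′; _×-dec_; contradiction)
  open import Relation.Nullary.Decidable using (decidable-stable)
  open import Relation.Binary.PropositionalEquality
  open import Algebra.Properties.Semiring.Sum +-*-semiring using (sum; sum-cong-≗)
  open FiniteSums
  open NatCongruence
  open PrimeDivisibility using (prime∤^)
  open GroupSemiring isAbelianGroup

  A? : Decidable A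
  A? x with factor x
  ... | _ , b , _ , Bb , _ with factor (x ∙ b)
  ... | a , _ , Aa , Bb′ , a∙b′≡x∙b =
    map′ (λ a≡x → subst A a≡x Aa) (λ Ax → proj₁ (factor-unique Aa Bb′ Ax Bb a∙b′≡x∙b)) (a ≟ x)

  B? : Decidable B
  B? y with factor y
  ... | a , _ , Aa , _ , _ with factor (a ∙ y)
  ... | _ , b , Aa′ , Bb , a′∙b≡a∙y =
    map′ (λ b≡y → subst B b≡y Bb) (λ By → proj₂ (factor-unique Aa′ Bb Aa By a′∙b≡a∙y)) (b ≟ y)

  𝟙A 𝟙B : ℕ[G]
  𝟙A x = iverson (A? x)
  𝟙B y = iverson (B? y)

  tiles : 𝟙A *ᴳ 𝟙B ≗ const 1
  tiles s with factor s
  ... | a , b , Aa , Bb , a∙b≡s = begin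
    (sum λ x → sum λ y → 𝟙A x * 𝟙B y * δ (x ∙ y) s)   ≡⟨ (sum-cong-≗ λ x → sum-cong-≗ λ y → term x y) ⟩
    (sum λ x → sum λ y → δ a x * δ b y)              ≡⟨ (sum-cong-≗ λ x → sum-*ˡ (δ a x) (δ b)) ⟩
    (sum λ x → δ a x * sum (δ b))                    ≡⟨ sum-δ a (const (sum (δ b))) ⟩
    sum (δ b)                                        ≡⟨ sum-δ-const b ⟩
    1                                                ∎
    where
    open ≡-Reasoning
    term : ∀ x y → 𝟙A x * 𝟙B y * δ (x ∙ y) s ≡ δ a x * δ b y
    term x y = begin
      iverson (A? x) * iverson (B? y) * iverson (x ∙ y ≟ s)
        ≡⟨ cong (_* iverson (x ∙ y ≟ s)) (iverson-* (A? x) (B? y)) ⟩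
      iverson (A? x ×-dec B? y) * iverson (x ∙ y ≟ s)
        ≡⟨ iverson-* (A? x ×-dec B? y) (x ∙ y ≟ s) ⟩
      iverson ((A? x ×-dec B? y) ×-dec (x ∙ y ≟ s))
        ≡⟨ iverson-resp ((A? x ×-dec B? y) ×-dec (x ∙ y ≟ s)) (a ≟ x ×-dec b ≟ y)
             (λ ((Ax , By) , x∙y≡s) → factor-unique Aa Bb Ax By (trans a∙b≡s (sym x∙y≡s)))
             (λ { (refl , refl) → (Aa , Bb) , a∙b≡s }) ⟩
      iverson (a ≟ x ×-dec b ≟ y)
        ≡⟨ iverson-* (a ≟ x) (b ≟ y) ⟨
      δ a x * δ b y ∎

  |A|*|B|≡n : sum 𝟙A * sum 𝟙B ≡ n
  |A|*|B|≡n = trans (sym (sum-*ᴳ 𝟙A 𝟙B)) (trans (sum-cong-≗ tiles) (sum-const-1 n))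

  Tiles : ℕ → Set
  Tiles t = pushforward (t ×ᵍ_) 𝟙A *ᴳ 𝟙B ≗ const 1

  tiles-1 : Tiles 1
  tiles-1 s = trans (*ᴳ-cong pushforward-1 (λ _ → refl) s) (tiles s)
    where
    pushforward-1 : pushforward (1 ×ᵍ_) 𝟙A ≗ 𝟙A
    pushforward-1 s = trans (sum-cong-≗ λ x → trans (*-comm (𝟙A x) (δ (1 ×ᵍ x) s))
                              (cong (_* 𝟙A x) (trans (cong (λ g → δ g s) (×ᵍ-homo-1 x)) (δ-comm x s))))
                            (sum-δ s 𝟙A)

  -- With F the dilate of 𝟙A by t: F^q *ᴳ 𝟙B is the constant |A|^(q-1), prime to q, and Frobenius makes it
  -- congruent to the dilate by q t convolved with 𝟙B; so that convolution is positive, with total |A||B| = n.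
  tiles-prime-* : ∀ {q t} → Prime q → q ∤ sum 𝟙A → Tiles t → Tiles (q * t)
  tiles-prime-* {q} {t} q-prime q∤|A| tiles-t = positive-sum≤length⇒≡1 (F′ *ᴳ 𝟙B) positive total≤n
    where
    instance _ = prime⇒nonZero q-prime
    F F′ : ℕ[G]
    F  = pushforward (t ×ᵍ_) 𝟙A
    F′ = pushforward ((q * t) ×ᵍ_) 𝟙A
    F^q*𝟙B : ∀ s → (F ^ᴳ q *ᴳ 𝟙B) s ≡ sum 𝟙A ^ pred q
    F^q*𝟙B s = begin
      (F ^ᴳ q *ᴳ 𝟙B) s                    ≡⟨ cong (λ k → (F ^ᴳ k *ᴳ 𝟙B) s) (sym (suc-pred q)) ⟩
      ((F *ᴳ F ^ᴳ pred q) *ᴳ 𝟙B) s        ≡⟨ *ᴳ-cong (*ᴳ-comm F (F ^ᴳ pred q)) (λ _ → refl) s ⟩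
      ((F ^ᴳ pred q *ᴳ F) *ᴳ 𝟙B) s        ≡⟨ *ᴳ-assoc (F ^ᴳ pred q) F 𝟙B s ⟩
      (F ^ᴳ pred q *ᴳ (F *ᴳ 𝟙B)) s        ≡⟨ *ᴳ-cong {F ^ᴳ pred q} (λ _ → refl) tiles-t s ⟩
      (F ^ᴳ pred q *ᴳ const 1) s          ≡⟨ *ᴳ-const (F ^ᴳ pred q) 1 s ⟩
      sum (F ^ᴳ pred q) * 1               ≡⟨ *-identityʳ (sum (F ^ᴳ pred q)) ⟩
      sum (F ^ᴳ pred q)                   ≡⟨ sum-^ᴳ F (pred q) ⟩
      sum F ^ pred q                      ≡⟨ cong (_^ pred q) (sum-pushforward (t ×ᵍ_) 𝟙A) ⟩
      sum 𝟙A ^ pred q                     ∎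
      where open ≡-Reasoning
    F′≡F^q : ∀ x → F′ x ≡ (F ^ᴳ q) x [modℕ q ]
    F′≡F^q x = ≡-modℕ-sym (≡-modℕ-trans
      (pushforward-^ᴳ-modℕ q q-prime (t ×ᵍ_) 𝟙A (λ y → iverson≤1 (A? y)) x)
      (≡-modℕ-reflexive (sum-cong-≗ λ y → cong (λ g → 𝟙A y * δ g x) (×ᵍ-assocˡ y q t))))
    positive : ∀ s → 1 ≤ (F′ *ᴳ 𝟙B) s
    positive s = n≢0⇒n>0 λ F′*𝟙B≡0 → prime∤^ q-prime q∤|A| (pred q) (≡0-modℕ⇒∣ (≡-modℕ-trans
      (≡-modℕ-sym (≡-modℕ-trans (*ᴳ-congˡ-modℕ 𝟙B F′≡F^q s) (≡-modℕ-reflexive (F^q*𝟙B s))))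
      (≡-modℕ-reflexive F′*𝟙B≡0)))
    total≤n : sum (F′ *ᴳ 𝟙B) ≤ n
    total≤n = ≤-reflexive
      (trans (sum-*ᴳ F′ 𝟙B) (trans (cong (_* sum 𝟙B) (sum-pushforward ((q * t) ×ᵍ_) 𝟙A)) |A|*|B|≡n))

  tiles-product : ∀ ps → All Prime ps → (∀ {p} → p ∈ ps → p ∤ sum 𝟙A) → Tiles (product ps)
  tiles-product []       []                   _      = tiles-1
  tiles-product (p ∷ ps) (p-prime ∷ ps-prime) ps∤|A| =
    tiles-prime-* p-prime (ps∤|A| (here refl)) (tiles-product ps ps-prime λ p∈ps → ps∤|A| (there p∈ps))

  tijdeman : ∀ t .{{_ : NonZero t}} → (∀ {p} → Prime p → p ∣ t → p ∤ sum 𝟙A) → Tiles t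
  tijdeman t t⊥|A| = subst Tiles (sym isFactorisation) (tiles-product factors factorsPrime λ {p} p∈factors →
    t⊥|A| (All.lookup factorsPrime p∈factors) (subst (p ∣_) (sym isFactorisation) (∈⇒∣product p∈factors)))
    where open PrimeFactorisation (factorise t)

  tiles-injective : ∀ {t x₁ x₂ y₁ y₂} → Tiles t → A x₁ → A x₂ → B y₁ → B y₂ →
                    (t ×ᵍ x₁) ∙ y₁ ≡ (t ×ᵍ x₂) ∙ y₂ → x₁ ≡ x₂
  tiles-injective {t} {x₁} {x₂} {y₁} tiles-t Ax₁ Ax₂ By₁ By₂ same-sum =
    decidable-stable (x₁ ≟ x₂) λ x₁≢x₂ → contradiction (begin
      2                                  ≤⟨ +-mono-≤ (H-positive Ax₁ By₁ refl) (H-positive Ax₂ By₂ (sym same-sum)) ⟩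
      H x₁ + H x₂                        ≤⟨ two-terms≤sum H x₁≢x₂ ⟩
      sum H                              ≡⟨ pushforward-*ᴳ (t ×ᵍ_) 𝟙A 𝟙B s ⟨
      (pushforward (t ×ᵍ_) 𝟙A *ᴳ 𝟙B) s   ≡⟨ tiles-t s ⟩
      1                                  ∎) λ { (s≤s ()) }
    where
    open ≤-Reasoning
    s : Fin n
    s = (t ×ᵍ x₁) ∙ y₁
    inner H : Fin n → ℕ
    inner x = sum λ y → 𝟙B y * δ ((t ×ᵍ x) ∙ y) s
    H x = 𝟙A x * inner x
    H-positive : ∀ {x y} → A x → B y → (t ×ᵍ x) ∙ y ≡ s → 1 ≤ H x
    H-positive {x} {y} Ax By tx∙y≡s = begin
      1                           ≡⟨ cong₂ _*_ (iverson-yes (B? y) By)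
                                               (trans (cong (λ g → δ g s) tx∙y≡s) (iverson-yes (s ≟ s) refl)) ⟨
      𝟙B y * δ ((t ×ᵍ x) ∙ y) s   ≤⟨ term≤sum (λ y → 𝟙B y * δ ((t ×ᵍ x) ∙ y) s) y ⟩
      inner x                     ≡⟨ *-identityˡ (inner x) ⟨
      1 * inner x                 ≡⟨ cong (_* inner x) (iverson-yes (A? x) Ax) ⟨
      H x                         ∎

module Residues (M : ℕ) .{{_ : NonZero M}} where

  import Data.Nat as ℕ
  import Data.Nat.Properties as ℕ
  import Data.Nat.Divisibility as ℕ
  open import Data.Nat.DivMod using (m<n⇒m%n≡m)
  open import Data.Integer
  open import Data.Integer.Properties
  open import Data.Integer.DivMod using (_%ℕ_; _/ℕ_; n%ℕd<d; a≡a%ℕn+[a/ℕn]*n)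
  open import Data.Integer.Divisibility.Signed using (∣⇒∣ᵤ)
  open import Data.Fin using (toℕ; fromℕ<)
  open import Data.Fin.Properties using (toℕ-fromℕ<; toℕ-injective; toℕ<n)
  open import Data.Product using (_,_)
  open import Relation.Binary.PropositionalEquality
  import Relation.Binary.Reasoning.Setoid as SetoidReasoning
  open import Defs using (ι)
  open Congruence
  open SetoidReasoning (≡-mod-setoid M)

  reduce : ℤ → Fin M
  reduce c = fromℕ< (n%ℕd<d c M)

  ι-reduce : ∀ c → ι (reduce c) ≡ c [mod M ]
  ι-reduce c = begin
    ι (reduce c)                  ≡⟨ cong +_ (toℕ-fromℕ< (n%ℕd<d c M)) ⟩
    + (c %ℕ M)                    ≈⟨ +-multiple-mod (+ (c %ℕ M)) (c /ℕ M) ⟨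
    + (c %ℕ M) + (c /ℕ M) * + M   ≡⟨ a≡a%ℕn+[a/ℕn]*n c M ⟨
    c                             ∎

  ι-injective-mod : ∀ {u v} → ι u ≡ ι v [mod M ] → u ≡ v
  ι-injective-mod {u} {v} (congruent M∣u-v) =
    toℕ-injective (+-injective (i-j≡0⇒i≡j (ι u) (ι v) (∣i∣≡0⇒i≡0 ∣u-v∣≡0)))
    where
    ∣u-v∣<M : ∣ ι u - ι v ∣ ℕ.< M
    ∣u-v∣<M = ℕ.≤-<-trans
      (subst (ℕ._≤ toℕ u ℕ.⊔ toℕ v) (cong ∣_∣ (sym (m-n≡m⊖n (toℕ u) (toℕ v))))
             (∣m⊝n∣≤m⊔n (toℕ u) (toℕ v)))
      (ℕ.⊔-lub (toℕ<n u) (toℕ<n v))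
    ∣u-v∣≡0 : ∣ ι u - ι v ∣ ≡ 0
    ∣u-v∣≡0 = trans (sym (m<n⇒m%n≡m ∣u-v∣<M)) (ℕ.n∣m⇒m%n≡0 ∣ ι u - ι v ∣ M (∣⇒∣ᵤ M∣u-v))

  reduce-cong : ∀ {c c′} → c ≡ c′ [mod M ] → reduce c ≡ reduce c′
  reduce-cong {c} {c′} c≡c′ = ι-injective-mod (begin
    ι (reduce c)    ≈⟨ ι-reduce c ⟩
    c               ≈⟨ c≡c′ ⟩
    c′              ≈⟨ ι-reduce c′ ⟨
    ι (reduce c′)   ∎)

  reduce-ι : ∀ u → reduce (ι u) ≡ u
  reduce-ι u = ι-injective-mod (ι-reduce (ι u))

  reduce-≡ : ∀ {c u} → c ≡ ι u [mod M ] → reduce c ≡ u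
  reduce-≡ {c} {u} c≡u = trans (reduce-cong c≡u) (reduce-ι u)

  infixl 6 _⊕_

  _⊕_ : Fin M → Fin M → Fin M
  x ⊕ y = reduce (ι x + ι y)

  𝟘 : Fin M
  𝟘 = reduce 0ℤ

  negate : Fin M → Fin M
  negate x = reduce (- ι x)

  ι-⊕ : ∀ x y → ι (x ⊕ y) ≡ ι x + ι y [mod M ]
  ι-⊕ x y = ι-reduce (ι x + ι y)

  ⊕-isAbelianGroup : IsAbelianGroup _≡_ _⊕_ 𝟘 negate
  ⊕-isAbelianGroup = record
    { isGroup = record
      { isMonoid = record
        { isSemigroup = record
          { isMagma = record { isEquivalence = isEquivalence ; ∙-cong = cong₂ _⊕_ }
          ; assoc = assoc }
        ; identity = identityˡ , λ x → trans (comm x 𝟘) (identityˡ x) }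
      ; inverse = (λ x → trans (comm (negate x) x) (inverseʳ x)) , inverseʳ
      ; ⁻¹-cong = cong negate }
    ; comm = comm }
    where
    assoc : ∀ x y z → (x ⊕ y) ⊕ z ≡ x ⊕ (y ⊕ z)
    assoc x y z = reduce-cong (begin
      ι (x ⊕ y) + ι z      ≈⟨ +-congʳ-mod (ι z) (ι-⊕ x y) ⟩
      ι x + ι y + ι z      ≡⟨ +-assoc (ι x) (ι y) (ι z) ⟩
      ι x + (ι y + ι z)    ≈⟨ +-congˡ-mod (ι x) (ι-⊕ y z) ⟨
      ι x + ι (y ⊕ z)      ∎)
    identityˡ : ∀ x → 𝟘 ⊕ x ≡ x
    identityˡ x = trans (reduce-cong (+-congʳ-mod (ι x) (ι-reduce 0ℤ))) (reduce-ι x)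
    inverseʳ : ∀ x → x ⊕ negate x ≡ 𝟘
    inverseʳ x = reduce-cong (begin
      ι x + ι (negate x)   ≈⟨ +-congˡ-mod (ι x) (ι-reduce (- ι x)) ⟩
      ι x - ι x            ≡⟨ +-inverseʳ (ι x) ⟩
      0ℤ                   ∎)
    comm : ∀ x y → x ⊕ y ≡ y ⊕ x
    comm x y = cong reduce (+-comm (ι x) (ι y))

  open GroupSemiring ⊕-isAbelianGroup using (_×ᵍ_)

  ι-×ᵍ : ∀ k x → ι (k ×ᵍ x) ≡ + k * ι x [mod M ]
  ι-×ᵍ ℕ.zero    x = ι-reduce 0ℤ
  ι-×ᵍ (ℕ.suc k) x = begin
    ι (x ⊕ k ×ᵍ x)          ≈⟨ ι-⊕ x (k ×ᵍ x) ⟩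
    ι x + ι (k ×ᵍ x)        ≈⟨ +-congˡ-mod (ι x) (ι-×ᵍ k x) ⟩
    ι x + + k * ι x         ≡⟨ cong (_+ + k * ι x) (*-identityˡ (ι x)) ⟨
    1ℤ * ι x + + k * ι x    ≡⟨ *-distribʳ-+ (ι x) 1ℤ (+ k) ⟨
    + ℕ.suc k * ι x         ∎

module UnitMultiplier where

  open import Data.Nat as ℕ using (ℕ; zero; suc; _^_; z<s; s<s)
  import Data.Nat.Properties as ℕ
  import Data.Nat.Divisibility as ℕ
  open import Data.Nat.Primality using (Prime; prime⇒irreducible)
  open import Data.Nat.Coprimality using (Coprime; coprime-Bézout; coprime-divisor; gcd≡1⇒coprime)
  open import Data.Nat.GCD using (gcd[m,n]∣m; gcd[m,n]∣n; module Bézout)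
  open import Data.Nat.Solver using (module +-*-Solver)
  open +-*-Solver using () renaming (solve to ℕ-solve; _:*_ to _ℕ:*_; _:=_ to _ℕ:=_)
  open import Data.Integer hiding (_^_; suc; NonZero)
  open import Data.Integer.Properties
  open import Data.Integer.Divisibility.Signed
  import Data.Integer.Solver as ℤ
  open import Data.Product using (∃; ∃₂; _×_; _,_)
  open import Data.Sum using (inj₁; inj₂)
  open import Function using (_∘_)
  open import Relation.Nullary using (¬_; yes; no; contradiction)
  open import Relation.Binary.PropositionalEquality
  import Relation.Binary.Reasoning.Setoid as SetoidReasoning
  open ℤ.+-*-Solver
  open Congruence

  split-valuation : ∀ P a α → ¬ (+ (P ^ a) ∣ α) →
                    ∃₂ λ e α′ → e ℕ.< a × α ≡ α′ * + (P ^ e) × ¬ (+ P ∣ α′)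
  split-valuation P zero    α P⁰∤α = contradiction (divides α (sym (*-identityʳ α))) P⁰∤α
  split-valuation P (suc a) α Pᵃ⁺¹∤α with + P ∣? α
  ... | no P∤α = 0 , α , z<s , sym (*-identityʳ α) , P∤α
  ... | yes (divides α₁ α≡α₁P) with split-valuation P a α₁ Pᵃ∤α₁
    where
    Pᵃ∤α₁ : ¬ (+ (P ^ a) ∣ α₁)
    Pᵃ∤α₁ Pᵃ∣α₁ = Pᵃ⁺¹∤α (subst₂ _∣_ (trans (*-comm (+ (P ^ a)) (+ P)) (sym (pos-* P (P ^ a))))
                                      (sym α≡α₁P) (*-monoˡ-∣ (+ P) Pᵃ∣α₁))
  ... | e , α′ , e<a , α₁≡α′Pᵉ , P∤α′ = suc e , α′ , s<s e<a , α≡α′Pᵉ⁺¹ , P∤α′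
    where
    α≡α′Pᵉ⁺¹ : α ≡ α′ * + (P ^ suc e)
    α≡α′Pᵉ⁺¹ = begin
      α                          ≡⟨ α≡α₁P ⟩
      α₁ * + P                   ≡⟨ cong (_* + P) α₁≡α′Pᵉ ⟩
      α′ * + (P ^ e) * + P       ≡⟨ solve 3 (λ x y z → x :* y :* z := x :* (z :* y)) refl α′ (+ (P ^ e)) (+ P) ⟩
      α′ * (+ P * + (P ^ e))     ≡⟨ cong (α′ *_) (pos-* P (P ^ e)) ⟨
      α′ * + (P ^ suc e)         ∎
      where open ≡-Reasoning

  coprime-to-primes : ∀ {P Q n} → Prime P → Prime Q → ¬ P ℕ.∣ n → ¬ Q ℕ.∣ n → Coprime n (P ℕ.* Q)
  coprime-to-primes {P} {Q} P-prime Q-prime P∤n Q∤n {i} (i∣n , i∣PQ) with prime⇒irreducible P-prime (gcd[m,n]∣n i P)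
  ... | inj₂ gcd≡P = contradiction (ℕ.∣-trans (subst (ℕ._∣ i) gcd≡P (gcd[m,n]∣m i P)) i∣n) P∤n
  ... | inj₁ gcd≡1 with prime⇒irreducible Q-prime (coprime-divisor (gcd≡1⇒coprime gcd≡1) i∣PQ)
  ...   | inj₁ i≡1  = i≡1
  ...   | inj₂ refl = contradiction i∣n Q∤n

  private
    ≡-mod-intro : ∀ {k x y} c → x ≡ y + c * + k → x ≡ y [mod k ]
    ≡-mod-intro {k} {x} {y} c refl = congruent (divides c (solve 3 (λ y c k → y :+ c :* k :- y := c :* k) refl y c (+ k)))

  inverse-modℕ : ∀ {n k} → Coprime n k → ∃ λ w → w * + n ≡ 1ℤ [mod k ]
  inverse-modℕ {n} {k} n⊥k with coprime-Bézout n⊥k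
  ... | Bézout.+- x y 1+yk≡xn = + x , ≡-mod-intro (+ y) (begin
    + x * + n            ≡⟨ pos-* x n ⟨
    + (x ℕ.* n)          ≡⟨ cong +_ 1+yk≡xn ⟨
    + (1 ℕ.+ y ℕ.* k)    ≡⟨ cong (λ a → 1ℤ + a) (pos-* y k) ⟩
    1ℤ + + y * + k       ∎)
    where open ≡-Reasoning
  ... | Bézout.-+ x y 1+xn≡yk = - + x , ≡-mod-intro (- + y) (begin
    - + x * + n               ≡⟨ solve 2 (λ x n → :- x :* n := con 1ℤ :+ :- (con 1ℤ :+ x :* n)) refl (+ x) (+ n) ⟩
    1ℤ - (1ℤ + + x * + n)     ≡⟨ cong (λ a → 1ℤ - (1ℤ + a)) (pos-* x n) ⟨
    1ℤ - + (1 ℕ.+ x ℕ.* n)    ≡⟨ cong (λ a → 1ℤ - + a) 1+xn≡yk ⟩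
    1ℤ - + (y ℕ.* k)          ≡⟨ cong (λ a → 1ℤ - a) (pos-* y k) ⟩
    1ℤ - + y * + k            ≡⟨ cong (λ a → 1ℤ + a) (neg-distribˡ-* (+ y) (+ k)) ⟩
    1ℤ + - + y * + k          ∎)
    where open ≡-Reasoning

  inverse-mod : ∀ α {k} → Coprime ∣ α ∣ k → ∃ λ w → w * α ≡ 1ℤ [mod k ]
  inverse-mod α α⊥k with inverse-modℕ α⊥k | +∣i∣≡i⊎+∣i∣≡-i α
  ... | w , w∣α∣≡1 | inj₁ ∣α∣≡α  = w , subst (λ a → w * a ≡ 1ℤ [mod _ ]) ∣α∣≡α w∣α∣≡1
  ... | w , w∣α∣≡1 | inj₂ ∣α∣≡-α = - w , subst (λ a → a ≡ 1ℤ [mod _ ])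
    (trans (cong (w *_) ∣α∣≡-α) (solve 2 (λ w α → w :* (:- α) := :- w :* α) refl w α)) w∣α∣≡1

  private
    P∣P^ : ∀ P {e a} → e ℕ.< a → P ℕ.∣ P ^ (a ℕ.∸ e)
    P∣P^ P {e} {a} e<a = subst (λ k → P ℕ.∣ P ^ k) (sym (ℕ.+-∸-assoc 1 e<a)) (ℕ.m∣m*n (P ^ (a ℕ.∸ suc e)))

    ^-∸-* : ∀ P {e a} → e ℕ.≤ a → P ^ (a ℕ.∸ e) ℕ.* P ^ e ≡ P ^ a
    ^-∸-* P {e} {a} e≤a = trans (sym (ℕ.^-distribˡ-+-* P (a ℕ.∸ e) e)) (cong (P ^_) (ℕ.m∸n+n≡m e≤a))

  -- Writing α = α′ Pᵉ Qᶠ with α′ prime to P Q, w α′ ≡ 1 (mod P Q) and δ = δ′ Pᵃ Qᵇ m, the multiplier is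
  -- x = δ′ w P^(a-e) Q^(b-f) m: then x α = δ′ (w α′) Pᵃ Qᵇ m ≡ δ (mod Pᵃ Qᵇ m P Q).
  unit-multiplier : ∀ {P Q} a b m → Prime P → Prime Q → ∀ α δ →
    ¬ (+ (P ^ a) ∣ α) → ¬ (+ (Q ^ b) ∣ α) → + (P ^ a ℕ.* Q ^ b ℕ.* m) ∣ δ →
    ∃ λ x → (+ P ∣ x) × (+ Q ∣ x) × (+ m ∣ x) × x * α ≡ δ [mod P ^ a ℕ.* Q ^ b ℕ.* m ℕ.* (P ℕ.* Q) ]
  unit-multiplier {P} {Q} a b m P-prime Q-prime α δ Pᵃ∤α Qᵇ∤α (divides δ′ δ≡δ′d)
    with split-valuation P a α Pᵃ∤α
  ... | e , α₁ , e<a , α≡α₁Pᵉ , P∤α₁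
    with split-valuation Q b α₁ (λ Qᵇ∣α₁ → Qᵇ∤α (subst (_ ∣_) (sym α≡α₁Pᵉ) (∣m⇒∣m*n (+ (P ^ e)) Qᵇ∣α₁)))
  ... | f , α′ , f<b , α₁≡α′Qᶠ , Q∤α′
    with inverse-mod α′ (coprime-to-primes P-prime Q-prime
           (λ P∣α′ → P∤α₁ (subst (_ ∣_) (sym α₁≡α′Qᶠ) (∣m⇒∣m*n (+ (Q ^ f)) (∣ᵤ⇒∣ {k = + P} {i = α′} P∣α′))))
           (Q∤α′ ∘ ∣ᵤ⇒∣ {k = + Q} {i = α′}))
  ... | w , wα′≡1 = x , x-multiple P∣c , x-multiple Q∣c , x-multiple m∣c , xα≡δ
    where
    d c : ℕ
    d = P ^ a ℕ.* Q ^ b ℕ.* m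
    c = P ^ (a ℕ.∸ e) ℕ.* Q ^ (b ℕ.∸ f) ℕ.* m
    x : ℤ
    x = δ′ * w * + c
    x-multiple : ∀ {k} → k ℕ.∣ c → + k ∣ x
    x-multiple k∣c = ∣n⇒∣m*n (δ′ * w) (∣ᵤ⇒∣ k∣c)
    P∣c : P ℕ.∣ c
    P∣c = ℕ.∣m⇒∣m*n m (ℕ.∣m⇒∣m*n (Q ^ (b ℕ.∸ f)) (P∣P^ P e<a))
    Q∣c : Q ℕ.∣ c
    Q∣c = ℕ.∣m⇒∣m*n m (ℕ.∣n⇒∣m*n (P ^ (a ℕ.∸ e)) (P∣P^ Q f<b))
    m∣c : m ℕ.∣ c
    m∣c = ℕ.∣n⇒∣m*n (P ^ (a ℕ.∸ e) ℕ.* Q ^ (b ℕ.∸ f)) ℕ.∣-refl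
    cQᶠPᵉ≡d : c ℕ.* Q ^ f ℕ.* P ^ e ≡ d
    cQᶠPᵉ≡d = begin
      P ^ (a ℕ.∸ e) ℕ.* Q ^ (b ℕ.∸ f) ℕ.* m ℕ.* Q ^ f ℕ.* P ^ e
        ≡⟨ ℕ-solve 5 (λ p q m q′ p′ → p ℕ:* q ℕ:* m ℕ:* q′ ℕ:* p′ ℕ:= (p ℕ:* p′) ℕ:* (q ℕ:* q′) ℕ:* m) refl
             (P ^ (a ℕ.∸ e)) (Q ^ (b ℕ.∸ f)) m (Q ^ f) (P ^ e) ⟩
      (P ^ (a ℕ.∸ e) ℕ.* P ^ e) ℕ.* (Q ^ (b ℕ.∸ f) ℕ.* Q ^ f) ℕ.* m
        ≡⟨ cong₂ (λ u v → u ℕ.* v ℕ.* m) (^-∸-* P (ℕ.<⇒≤ e<a)) (^-∸-* Q (ℕ.<⇒≤ f<b)) ⟩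
      d ∎
      where open ≡-Reasoning
    xα≡δ : x * α ≡ δ [mod d ℕ.* (P ℕ.* Q) ]
    xα≡δ = begin
      δ′ * w * + c * α
        ≡⟨ cong (δ′ * w * + c *_) (trans α≡α₁Pᵉ (cong (_* + (P ^ e)) α₁≡α′Qᶠ)) ⟩
      δ′ * w * + c * (α′ * + (Q ^ f) * + (P ^ e))
        ≡⟨ solve 6 (λ δ′ w c α′ q p → δ′ :* w :* c :* (α′ :* q :* p) := δ′ :* ((c :* q :* p) :* (w :* α′)))
                   refl δ′ w (+ c) α′ (+ (Q ^ f)) (+ (P ^ e)) ⟩
      δ′ * (+ c * + (Q ^ f) * + (P ^ e) * (w * α′))
        ≡⟨ cong (λ k → δ′ * (k * (w * α′))) (trans (pos-* (c ℕ.* Q ^ f) (P ^ e)) (cong (_* + (P ^ e)) (pos-* c (Q ^ f)))) ⟨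
      δ′ * (+ (c ℕ.* Q ^ f ℕ.* P ^ e) * (w * α′))
        ≡⟨ cong (λ k → δ′ * (+ k * (w * α′))) cQᶠPᵉ≡d ⟩
      δ′ * (+ d * (w * α′))
        ≈⟨ *-congˡ-mod δ′ (*-scale-mod d wα′≡1) ⟩
      δ′ * (+ d * 1ℤ)
        ≡⟨ solve 2 (λ δ′ d → δ′ :* (d :* con 1ℤ) := δ′ :* d) refl δ′ (+ d) ⟩
      δ′ * + d
        ≡⟨ δ≡δ′d ⟨
      δ ∎
      where open SetoidReasoning (≡-mod-setoid (d ℕ.* (P ℕ.* Q)))

module DirectSum (M : ℕ) .{{_ : NonZero M}} {A B : Fin M → Set} (direct : IsDirectSum M A B) where

  import Data.Nat as ℕ
  import Data.Nat.Properties as ℕ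
  open import Data.Nat.Divisibility as ℕ using (divides)
  open import Data.Nat.Primality using (Prime; euclidsLemma)
  open import Data.Fin using (toℕ)
  open import Data.Fin.Properties using (all?)
  open import Data.Integer hiding (_^_; suc; NonZero)
  open import Data.Integer.Divisibility.Signed
  open import Data.Integer.Properties using (+-inverseʳ)
  open import Data.Integer.Solver using (module +-*-Solver)
  open import Data.Empty using (⊥; ⊥-elim)
  open import Data.Product using (∃; _,_; proj₁; proj₂)
  open import Data.Sum as Sum using (_⊎_; inj₁; inj₂)
  open import Function using (_∘_)
  open import Relation.Nullary using (¬_; Dec; yes; no; contradiction)
  open import Relation.Nullary.Decidable using (_→-dec_; decidable-stable; toSum)
  open import Relation.Binary.PropositionalEquality
  import Relation.Binary.Reasoning.Setoid as SetoidReasoning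
  open import Algebra.Properties.Semiring.Sum ℕ.+-*-semiring using (sum)
  open import Defs using (ι; _≡[_]_; ΣA; ΣB; Λ; Π)
  open +-*-Solver
  open Congruence
  open Residues M
  open PrimeDivisibility using (prime∣^⇒∣; prime∤1)
  open UnitMultiplier using (unit-multiplier)

  factor : ∀ s → ∃₂ λ x y → A x × B y × x ⊕ y ≡ s
  factor s with proj₁ (direct s)
  ... | x , y , Ax , By , x+y≡s = x , y , Ax , By , reduce-≡ (fromDefs (ι x + ι y) (ι s) x+y≡s)

  factor-unique : ∀ {x y x′ y′} → A x → B y → A x′ → B y′ → x ⊕ y ≡ x′ ⊕ y′ → x ≡ x′ × y ≡ y′
  factor-unique {x} {y} {x′} {y′} Ax By Ax′ By′ x⊕y≡x′⊕y′ =
    proj₂ (direct (x ⊕ y)) x y x′ y′ Ax By Ax′ By′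
    (toDefs (≡-mod-sym (ι-⊕ x y)))
    (toDefs (≡-mod-sym (subst (λ s → ι s ≡ ι x′ + ι y′ [mod M ]) (sym x⊕y≡x′⊕y′) (ι-⊕ x′ y′))))

  open Tiling ⊕-isAbelianGroup factor factor-unique
  open GroupSemiring ⊕-isAbelianGroup using (_×ᵍ_)

  dilated-sum-injective : ∀ t .{{_ : NonZero t}} → (∀ {p} → Prime p → p ℕ.∣ t → ¬ p ℕ.∣ M) →
    ∀ {x₁ x₂ y₁ y₂} → A x₁ → A x₂ → B y₁ → B y₂ →
    + t * ι x₁ + ι y₁ ≡ + t * ι x₂ + ι y₂ [mod M ] → x₁ ≡ x₂
  dilated-sum-injective t t⊥M {x₁} {x₂} {y₁} {y₂} Ax₁ Ax₂ By₁ By₂ sums≡ =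
    tiles-injective {t} (tijdeman t λ p-prime p∣t p∣|A| → t⊥M p-prime p∣t (ℕ.∣-trans p∣|A| |A|∣M))
      Ax₁ Ax₂ By₁ By₂
      (ι-injective-mod (begin
        ι ((t ×ᵍ x₁) ⊕ y₁)     ≈⟨ ι-⊕ (t ×ᵍ x₁) y₁ ⟩
        ι (t ×ᵍ x₁) + ι y₁     ≈⟨ +-congʳ-mod (ι y₁) (ι-×ᵍ t x₁) ⟩
        + t * ι x₁ + ι y₁      ≈⟨ sums≡ ⟩
        + t * ι x₂ + ι y₂      ≈⟨ +-congʳ-mod (ι y₂) (ι-×ᵍ t x₂) ⟨
        ι (t ×ᵍ x₂) + ι y₂     ≈⟨ ι-⊕ (t ×ᵍ x₂) y₂ ⟨
        ι ((t ×ᵍ x₂) ⊕ y₂)     ∎))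
    where
    open SetoidReasoning (≡-mod-setoid M)
    |A|∣M : sum 𝟙A ℕ.∣ M
    |A|∣M = divides (sum 𝟙B) (trans (sym |A|*|B|≡n) (ℕ.*-comm (sum 𝟙A) (sum 𝟙B)))

  module _ {P Q : ℕ} (a b m : ℕ) (P-prime : Prime P) (Q-prime : Prime Q)
           (M≡dPQ : M ≡ P ℕ.^ a ℕ.* Q ℕ.^ b ℕ.* m ℕ.* (P ℕ.* Q)) where

    private
      d : ℕ
      d = P ℕ.^ a ℕ.* Q ℕ.^ b ℕ.* m

      d∣M : d ℕ.∣ M
      d∣M = divides (P ℕ.* Q) (trans M≡dPQ (ℕ.*-comm d (P ℕ.* Q)))

      prime∣M : ∀ {p} → Prime p → p ℕ.∣ M → p ℕ.∣ P ⊎ p ℕ.∣ Q ⊎ p ℕ.∣ m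
      prime∣M {p} p-prime p∣M with euclidsLemma d (P ℕ.* Q) p-prime (subst (p ℕ.∣_) M≡dPQ p∣M)
      ... | inj₂ p∣PQ with euclidsLemma P Q p-prime p∣PQ
      ...   | inj₁ p∣P = inj₁ p∣P
      ...   | inj₂ p∣Q = inj₂ (inj₁ p∣Q)
      prime∣M {p} p-prime p∣M | inj₁ p∣d with euclidsLemma (P ℕ.^ a ℕ.* Q ℕ.^ b) m p-prime p∣d
      ... | inj₂ p∣m = inj₂ (inj₂ p∣m)
      ... | inj₁ p∣PᵃQᵇ with euclidsLemma (P ℕ.^ a) (Q ℕ.^ b) p-prime p∣PᵃQᵇ
      ...   | inj₁ p∣Pᵃ = inj₁ (prime∣^⇒∣ a p-prime p∣Pᵃ)
      ...   | inj₂ p∣Qᵇ = inj₂ (inj₁ (prime∣^⇒∣ b p-prime p∣Qᵇ))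

      -- With x from unit-multiplier, t = 1 + (x mod M) is prime to M and t (x₁ - x₂) ≡ y₂ - y₁ (mod M).
      neither-divides⇒⊥ : ∀ {x₁ y₁ x₂ y₂} → A x₁ → B y₁ → A x₂ → B y₂ →
                          ι x₁ + ι y₁ ≡ ι x₂ + ι y₂ [mod d ] →
                          ¬ (+ (P ℕ.^ a) ∣ ι x₁ - ι x₂) → ¬ (+ (Q ℕ.^ b) ∣ ι x₁ - ι x₂) → ⊥
      neither-divides⇒⊥ {x₁} {y₁} {x₂} {y₂} Ax₁ By₁ Ax₂ By₂ (congruent d∣sums) Pᵃ∤α Qᵇ∤α =
        refute (unit-multiplier a b m P-prime Q-prime α δ Pᵃ∤α Qᵇ∤α d∣δ)
        where
        α δ : ℤ
        α = ι x₁ - ι x₂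
        δ = (ι y₂ - ι y₁) - α
        d∣δ : + d ∣ δ
        d∣δ = subst (_ ∣_)
          (solve 4 (λ x₁ y₁ x₂ y₂ → :- ((x₁ :+ y₁) :- (x₂ :+ y₂)) := (y₂ :- y₁) :- (x₁ :- x₂))
                   refl (ι x₁) (ι y₁) (ι x₂) (ι y₂))
          (∣m⇒∣-m d∣sums)
        refute : (∃ λ x → (+ P ∣ x) × (+ Q ∣ x) × (+ m ∣ x) × x * α ≡ δ [mod d ℕ.* (P ℕ.* Q) ]) → ⊥
        refute (x , P∣x , Q∣x , m∣x , xα≡δ) = Pᵃ∤α (subst (λ x → + (P ℕ.^ a) ∣ ι x₁ - ι x) x₁≡x₂
          (subst (_ ∣_) (sym (+-inverseʳ (ι x₁))) (divides 0ℤ refl)))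
          where
          open SetoidReasoning (≡-mod-setoid M)
          r : ℕ
          r = toℕ (reduce x)
          t⊥M : ∀ {p} → Prime p → p ℕ.∣ ℕ.suc r → ¬ p ℕ.∣ M
          t⊥M {p} p-prime p∣1+r p∣M =
            prime∤1 p-prime (ℕ.∣m+n∣m⇒∣n (subst (p ℕ.∣_) (ℕ.+-comm 1 r) p∣1+r) p∣r)
            where
            p∣x : + p ∣ x
            p∣x with prime∣M p-prime p∣M
            ... | inj₁ p∣P        = ∣-trans (∣ᵤ⇒∣ p∣P) P∣x
            ... | inj₂ (inj₁ p∣Q) = ∣-trans (∣ᵤ⇒∣ p∣Q) Q∣x
            ... | inj₂ (inj₂ p∣m) = ∣-trans (∣ᵤ⇒∣ p∣m) m∣x
            p∣r : p ℕ.∣ r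
            p∣r = ∣⇒∣ᵤ (subst (_ ∣_) (solve 2 (λ r x → (r :- x) :+ x := r) refl (+ r) x)
                        (∣m∣n⇒∣m+n (∣-trans (∣ᵤ⇒∣ p∣M) (divides-difference (ι-reduce x))) p∣x))
          tα≡β : + ℕ.suc r * α ≡ ι y₂ - ι y₁ [mod M ]
          tα≡β = begin
            (1ℤ + + r) * α    ≈⟨ *-congʳ-mod α (+-congˡ-mod 1ℤ (ι-reduce x)) ⟩
            (1ℤ + x) * α      ≡⟨ solve 2 (λ x α → (con 1ℤ :+ x) :* α := α :+ x :* α) refl x α ⟩
            α + x * α         ≈⟨ +-congˡ-mod α (subst (λ k → x * α ≡ δ [mod k ]) (sym M≡dPQ) xα≡δ) ⟩
            α + δ             ≡⟨ solve 2 (λ α β → α :+ (β :- α) := β) refl α (ι y₂ - ι y₁) ⟩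
            ι y₂ - ι y₁       ∎
          x₁≡x₂ : x₁ ≡ x₂
          x₁≡x₂ = dilated-sum-injective (ℕ.suc r) t⊥M Ax₁ Ax₂ By₁ By₂ (begin
            + ℕ.suc r * ι x₁ + ι y₁
              ≡⟨ solve 4 (λ t x₁ x₂ y₁ → t :* x₁ :+ y₁ := t :* (x₁ :- x₂) :+ (t :* x₂ :+ y₁))
                         refl (+ ℕ.suc r) (ι x₁) (ι x₂) (ι y₁) ⟩
            + ℕ.suc r * α + (+ ℕ.suc r * ι x₂ + ι y₁)
              ≈⟨ +-congʳ-mod (+ ℕ.suc r * ι x₂ + ι y₁) tα≡β ⟩
            ι y₂ - ι y₁ + (+ ℕ.suc r * ι x₂ + ι y₁)
              ≡⟨ solve 4 (λ t x₂ y₁ y₂ → y₂ :- y₁ :+ (t :* x₂ :+ y₁) := t :* x₂ :+ y₂)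
                         refl (+ ℕ.suc r) (ι x₂) (ι y₁) (ι y₂) ⟩
            + ℕ.suc r * ι x₂ + ι y₂ ∎)

    divisor-exclusion : ∀ {x₁ y₁ x₂ y₂} → A x₁ → B y₁ → A x₂ → B y₂ →
                        ι x₁ + ι y₁ ≡ ι x₂ + ι y₂ [mod d ] →
                        ι x₁ ≡ ι x₂ [mod P ℕ.^ a ] ⊎ ι x₁ ≡ ι x₂ [mod Q ℕ.^ b ]
    divisor-exclusion {x₁} {y₁} {x₂} {y₂} Ax₁ By₁ Ax₂ By₂ sums≡
      with ι x₁ ≡? ι x₂ [mod P ℕ.^ a ] | ι x₁ ≡? ι x₂ [mod Q ℕ.^ b ]
    ... | yes x₁≡x₂ | _         = inj₁ x₁≡x₂
    ... | no _      | yes x₁≡x₂ = inj₂ x₁≡x₂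
    ... | no x₁≢x₂  | no x₁≢′x₂ =
      ⊥-elim (neither-divides⇒⊥ Ax₁ By₁ Ax₂ By₂ sums≡ (x₁≢x₂ ∘ congruent) (x₁≢′x₂ ∘ congruent))

    module _ {z a₀ b₀ : Fin M} (Aa₀ : A a₀) (Bb₀ : B b₀) (a₀+b₀≡z : ι a₀ + ι b₀ ≡ ι z [mod M ]) where

      -- Near k says Σ_A(Λ(z, d)) ⊆ Π(a₀, k), quantifying over the pairs (x, y) that put x into Σ_A.
      Near : ℕ → Set
      Near k = ∀ x y → A x → B y → ι x + ι y ≡ ι z [mod d ] → ι a₀ ≡ ι x [mod k ]

      Near? : ∀ k → Dec (Near k)
      Near? k = all? λ x → all? λ y →
        A? x →-dec (B? y →-dec ((ι x + ι y ≡? ι z [mod d ]) →-dec (ι a₀ ≡? ι x [mod k ])))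

      private
        exclusion-with-a₀ : ∀ {x y} → A x → B y → ι x + ι y ≡ ι z [mod d ] →
                            ι a₀ ≡ ι x [mod P ℕ.^ a ] ⊎ ι a₀ ≡ ι x [mod Q ℕ.^ b ]
        exclusion-with-a₀ Ax By x+y≡z =
          divisor-exclusion Aa₀ Bb₀ Ax By (≡-mod-trans (≡-mod-weaken d∣M a₀+b₀≡z) (≡-mod-sym x+y≡z))

      far-from-Pᵃ⇒near-Qᵇ : ∀ {x y} → A x → B y → ι x + ι y ≡ ι z [mod d ] →
                            ¬ (ι a₀ ≡ ι x [mod P ℕ.^ a ]) → Near (Q ℕ.^ b)
      far-from-Pᵃ⇒near-Qᵇ {x} {y} Ax By x+y≡z a₀≢x x′ y′ Ax′ By′ x′+y′≡z
        with exclusion-with-a₀ Ax′ By′ x′+y′≡z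
      ... | inj₂ a₀≡x′ = a₀≡x′
      ... | inj₁ a₀≡x′ with divisor-exclusion Ax′ By′ Ax By (≡-mod-trans x′+y′≡z (≡-mod-sym x+y≡z))
                          | exclusion-with-a₀ Ax By x+y≡z
      ...   | inj₁ x′≡x | _         = contradiction (≡-mod-trans a₀≡x′ x′≡x) a₀≢x
      ...   | _         | inj₁ a₀≡x = contradiction a₀≡x a₀≢x
      ...   | inj₂ x′≡x | inj₂ a₀≡x = ≡-mod-trans a₀≡x (≡-mod-sym x′≡x)

      near-Pᵃ-or-Qᵇ : Near (P ℕ.^ a) ⊎ Near (Q ℕ.^ b)
      near-Pᵃ-or-Qᵇ = Sum.[ inj₂ , (λ ¬near-Qᵇ → inj₁ λ x y Ax By x+y≡z →
          decidable-stable (ι a₀ ≡? ι x [mod P ℕ.^ a ]) λ a₀≢x →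
            ¬near-Qᵇ (far-from-Pᵃ⇒near-Qᵇ Ax By x+y≡z a₀≢x)) ]′
        (toSum (Near? (Q ℕ.^ b)))

      Σ⊆Π : ℕ → Set
      Σ⊆Π k = (∀ x → ΣA A B (Λ z d) x → A x × Π a₀ k x) × (∀ y → ΣB A B (Λ z d) y → B y × Π b₀ k y)

      near⇒Σ⊆Π : ∀ {k} → k ℕ.∣ d → Near k → Σ⊆Π k
      near⇒Σ⊆Π {k} k∣d near = ΣA⊆Π , ΣB⊆Π
        where
        sum-in-Λ : ∀ x y c → (ι x + ι y) ≡[ M ] ι c → Λ z d c → ι x + ι y ≡ ι z [mod d ]
        sum-in-Λ x y c x+y≡c z≡c =
          ≡-mod-trans (≡-mod-weaken d∣M (fromDefs (ι x + ι y) (ι c) x+y≡c)) (≡-mod-sym (fromDefs (ι z) (ι c) z≡c))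
        ΣA⊆Π : ∀ x → ΣA A B (Λ z d) x → A x × Π a₀ k x
        ΣA⊆Π x (Ax , y , By , c , x+y≡c , c∈Λ) = Ax , toDefs (near x y Ax By (sum-in-Λ x y c x+y≡c c∈Λ))
        ΣB⊆Π : ∀ y → ΣB A B (Λ z d) y → B y × Π b₀ k y
        ΣB⊆Π y (By , x , Ax , c , x+y≡c , c∈Λ) =
          By , toDefs (+-cancelˡ-mod {y = ι b₀} {y′ = ι y} a₀+b₀≡x+y a₀≡x)
          where
          x+y≡z : ι x + ι y ≡ ι z [mod d ]
          x+y≡z = sum-in-Λ x y c x+y≡c c∈Λ
          a₀≡x : ι a₀ ≡ ι x [mod k ]
          a₀≡x = near x y Ax By x+y≡z
          a₀+b₀≡x+y : ι a₀ + ι b₀ ≡ ι x + ι y [mod k ]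
          a₀+b₀≡x+y = ≡-mod-weaken k∣d (≡-mod-trans (≡-mod-weaken d∣M a₀+b₀≡z) (≡-mod-sym x+y≡z))

      Σ⊆Π-Pᵃ-or-Qᵇ : Σ⊆Π (P ℕ.^ a) ⊎ Σ⊆Π (Q ℕ.^ b)
      Σ⊆Π-Pᵃ-or-Qᵇ = Sum.map (near⇒Σ⊆Π (ℕ.∣m⇒∣m*n m (ℕ.∣m⇒∣m*n (Q ℕ.^ b) ℕ.∣-refl)))
                             (near⇒Σ⊆Π (ℕ.∣m⇒∣m*n m (ℕ.∣n⇒∣m*n (P ℕ.^ a) ℕ.∣-refl)))
                             near-Pᵃ-or-Qᵇ

module PrimePowerProducts where

  open import Data.Nat
  open import Data.Nat.Properties
  open import Data.Nat.ListAction using (product)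
  open import Data.Nat.Primality using (Prime; prime⇒nonZero)
  open import Data.Nat.Solver using (module +-*-Solver)
  open import Data.List using (tabulate)
  open import Data.Fin using (zero; suc; punchIn; punchOut)
  open import Data.Fin.Properties using (punchIn-punchOut)
  open import Data.Product using (∃; _,_)
  open import Relation.Nullary using (contradiction)
  open import Relation.Binary.PropositionalEquality
  open +-*-Solver

  product-tabulate-punchIn : ∀ {K} (f : Fin (suc K) → ℕ) i →
                             product (tabulate f) ≡ f i * product (tabulate λ k → f (punchIn i k))
  product-tabulate-punchIn f zero = refl
  product-tabulate-punchIn {suc K} f (suc i) =
    trans (cong (f zero *_) (product-tabulate-punchIn (λ k → f (suc k)) i))
          (solve 3 (λ a b c → a :* (b :* c) := b :* (a :* c)) refl
                   (f zero) (f (suc i)) (product (tabulate λ k → f (suc (punchIn i k)))))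

  product-tabulate-two : ∀ {K} (f : Fin K → ℕ) {i j} → i ≢ j → ∃ λ m → product (tabulate f) ≡ f i * (f j * m)
  product-tabulate-two {suc zero}    f {zero} {zero} i≢j = contradiction refl i≢j
  product-tabulate-two {suc (suc K)} f {i} {j} i≢j = rest , trans (product-tabulate-punchIn f i) (cong (f i *_)
    (trans (product-tabulate-punchIn (λ k → f (punchIn i k)) (punchOut i≢j))
           (cong (λ l → f l * rest) (punchIn-punchOut i≢j))))
    where
    rest : ℕ
    rest = product (tabulate λ k → f (punchIn i (punchIn (punchOut i≢j) k)))

  cofactor-of-two-primes : ∀ {K} (p n : Fin K → ℕ) → (∀ ν → Prime (p ν)) → (∀ ν → 1 ≤ n ν) →
    ∀ {i j} → i ≢ j → ∀ d → d * (p i * p j) ≡ product (tabulate λ ν → p ν ^ n ν) →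
    ∃ λ m → d ≡ p i ^ (n i ∸ 1) * p j ^ (n j ∸ 1) * m
  cofactor-of-two-primes p n p-prime n≥1 {i} {j} i≢j d dpᵢpⱼ≡M with product-tabulate-two (λ ν → p ν ^ n ν) i≢j
  ... | m , M≡ = m , *-cancelʳ-≡ d (p i ^ (n i ∸ 1) * p j ^ (n j ∸ 1) * m) (p i * p j) {{pᵢpⱼ≢0}} (begin
    d * (p i * p j)
      ≡⟨ dpᵢpⱼ≡M ⟩
    product (tabulate λ ν → p ν ^ n ν)
      ≡⟨ M≡ ⟩
    p i ^ n i * (p j ^ n j * m)
      ≡⟨ cong₂ (λ a b → p i ^ a * (p j ^ b * m)) (+-∸-assoc 1 (n≥1 i)) (+-∸-assoc 1 (n≥1 j)) ⟩
    p i * p i ^ (n i ∸ 1) * (p j * p j ^ (n j ∸ 1) * m)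
      ≡⟨ solve 5 (λ P Pᵃ Q Qᵇ m → P :* Pᵃ :* (Q :* Qᵇ :* m) := Pᵃ :* Qᵇ :* m :* (P :* Q))
                 refl (p i) (p i ^ (n i ∸ 1)) (p j) (p j ^ (n j ∸ 1)) m ⟩
    p i ^ (n i ∸ 1) * p j ^ (n j ∸ 1) * m * (p i * p j) ∎)
    where
    open ≡-Reasoning
    pᵢpⱼ≢0 : NonZero (p i * p j)
    pᵢpⱼ≢0 = m*n≢0 (p i) (p j) {{prime⇒nonZero (p-prime i)}} {{prime⇒nonZero (p-prime j)}}

  Fin-nonZero : ∀ {M} → Fin M → NonZero M
  Fin-nonZero {suc _} _ = _

open import Defs
open import Data.Nat using (_*_; _^_; _∸_; _≤_)
open import Data.Nat.Primality using (Prime)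
open import Data.Integer using (_+_)
open import Data.Product using (∃-syntax; _,_)
open import Data.Sum as Sum using (_⊎_; inj₁; inj₂)
open import Function.Definitions using (Injective)
open import Relation.Binary.PropositionalEquality using (_≢_; refl; sym)
open Congruence using (fromDefs)
open PrimePowerProducts using (cofactor-of-two-primes; Fin-nonZero)
open DirectSum using (Σ⊆Π-Pᵃ-or-Qᵇ)

lemma7p1 : (K : ℕ) (p n : Fin K → ℕ) →
    (∀ ν → Prime (p ν)) → Injective _≡_ _≡_ p → (∀ ν → 1 ≤ n ν) →
    (A B : Fin (primePowerProduct K p n) → Set) →
    IsDirectSum (primePowerProduct K p n) A B →
    (i j : Fin K) → i ≢ j →
    (z : Fin (primePowerProduct K p n)) →
    (d : ℕ) → d * (p i * p j) ≡ primePowerProduct K p n →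
    (a b : Fin (primePowerProduct K p n)) → A a → B b →
    (ι a + ι b) ≡[ primePowerProduct K p n ] ι z →
    ∃[ ν ] ((ν ≡ i ⊎ ν ≡ j)
      × (∀ x → ΣA A B (Λ z d) x → A x × Π a (p ν ^ (n ν ∸ 1)) x)
      × (∀ y → ΣB A B (Λ z d) y → B y × Π b (p ν ^ (n ν ∸ 1)) y))
lemma7p1 K p n p-prime _ n≥1 A B direct i j i≢j z d dpᵢpⱼ≡M a b Aa Bb a+b≡z
  with cofactor-of-two-primes p n p-prime n≥1 i≢j d dpᵢpⱼ≡M
... | m , refl = Sum.[ (λ Σ⊆Πᵢ → i , inj₁ refl , Σ⊆Πᵢ) , (λ Σ⊆Πⱼ → j , inj₂ refl , Σ⊆Πⱼ) ]′
  (Σ⊆Π-Pᵃ-or-Qᵇ (primePowerProduct K p n) {{Fin-nonZero a}} direct (n i ∸ 1) (n j ∸ 1) m (p-prime i) (p-prime j)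
    (sym dpᵢpⱼ≡M) Aa Bb (fromDefs (ι a + ι b) (ι z) a+b≡z))
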